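{- Let $K$ be a field of characteristic zero and let $f\in K[[x]]$ be a compositionally invertible formal power series with $f\neq\mathrm{id}$, with Taylor coefficients $f_n=D^n(f)(0)$. Then $f$ is involutory (i.e. $f\circ f=\mathrm{id}$) if and only if there exist constants $g_1\,(\neq0),g_2,g_3,\ldots\in K$ such that $f_n=L_{n,1}(g_1,g_2,\ldots,g_{2[n/2]})$ for all $n\ge1$.
   Context: A formal power series $f\in K[[x]]$ is compositionally invertible iff $f(0)=0$ and $f'(0)\neq0$; $\mathrm{id}(x)=x$. $D^n(f)(0)$ is the $n$-th Taylor coefficient $n!\,[x^n]f$. $B_{n,k}\in K[X_1,\ldots,X_{n-k+1}]$ is the partial Bell polynomial $B_{n,k}=\sum \frac{n!}{k_1!k_2!\cdots}\prod_j (X_j/j!)^{k_j}$ over nonnegative $k_1,k_2,\ldots$ with $\sum k_j=k$, $\sum jk_j=n$. $A_{n,k}\in K[X_1^{ -1},X_2,\ldots,X_{n-k+1}]$ ($1\le k\le n$) are the unique Laurent polynomials with $\sum_{j=k}^n A_{n,j}B_{j,k}=\delta_{nk}$ for $1\le k\le n$ (equivalently, $A_{n,k}(g_1,\ldots,g_{n-k+1})$ is the $n$-th Taylor coefficient of $(g^{ -1})^k/k!$ for every invertible $g$ with Taylor coefficients $g_r$, $g^{ -1}$ the compositional inverse). The multivariable Lah polynomials are $L_{n,k}=\sum_{j=k}^n(-1)^jA_{n,j}B_{j,k}$. The polynomial $L_{n,1}$ involves only $X_1,\ldots,X_{2[n/2]}$ ($[\cdot]$ the integer part), and $L_{n,1}(g_1,\ldots,g_{2[n/2]})$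 denotes substitution $X_j=g_j$. -}

module Defs where

open import Level using (Level; _⊔_) renaming (suc to lsuc)
open import Algebra.Bundles using (CommutativeRing)
import Algebra.Bundles
open import Data.Nat using (ℕ; zero; suc; _∸_; _≡ᵇ_) renaming (_+_ to _ℕ+_; _*_ to _ℕ*_)
open import Data.Nat using (_!)
open import Data.Bool using (if_then_else_)
open import Data.Fin using (Fin; toℕ)
open import Data.Vec using (Vec; []; _∷_)
open import Data.List using (List; []; _∷_; _++_; map; concatMap; foldr)
open import Data.Product using (_×_; _,_)
open import Relation.Nullary using (¬_)

-- Fields (not available in agda-stdlib): a commutative ring with
-- 0 ≉ 1 and a multiplicative inverse for every nonzero element.
-- The inverse is a total function; its value at 0 is irrelevant.

record Field (c ℓ : Level) : Set (lsuc (c ⊔ ℓ)) where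
  field
    commutativeRing : CommutativeRing c ℓ
  open CommutativeRing commutativeRing public
  field
    _⁻¹      : Carrier → Carrier
    0≉1      : ¬ (0# ≈ 1#)
    ⁻¹-inverse : ∀ x → ¬ (x ≈ 0#) → (x * (x ⁻¹)) ≈ 1#

module FieldTheory {c ℓ : Level} (F : Field c ℓ) where
  open Field F
  open import Algebra.Definitions.RawSemiring (Algebra.Bundles.Semiring.rawSemiring semiring) using (_^_) renaming (_×_ to _·_)

  fromℕ : ℕ → Carrier
  fromℕ n = n · 1#

  CharZero : Set ℓ
  CharZero = ∀ n → ¬ (fromℕ (suc n) ≈ 0#)

  sumFrom : ℕ → ℕ → (ℕ → Carrier) → Carrier
  sumFrom k zero    f = 0#
  sumFrom k (suc l) f = f k + sumFrom (suc k) l f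

  -- Σ_{j = k}^{n} f j  (empty if n < k)
  Σ[_⋯_] : ℕ → ℕ → (ℕ → Carrier) → Carrier
  Σ[ k ⋯ n ] f = sumFrom k (suc n ∸ k) f

  -- formal power series K[[x]], given by ordinary coefficients [x^n] f

  Series : Set c
  Series = ℕ → Carrier

  idS : Series
  idS n = if n ≡ᵇ 1 then 1# else 0#

  oneS : Series
  oneS n = if n ≡ᵇ 0 then 1# else 0#

  mulS : Series → Series → Series
  mulS f g n = Σ[ 0 ⋯ n ] (λ i → f i * g (n ∸ i))

  powS : Series → ℕ → Series
  powS f zero    = oneS
  powS f (suc k) = mulS f (powS f k)

  -- composition f ∘ g = Σ_k f_k g^k  (meaningful when g(0) = 0)
  compS : Series → Series → Series
  compS f g n = Σ[ 0 ⋯ n ] (λ k → f k * powS g k n)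

  -- Taylor coefficient D^n(f)(0) = n! [x^n] f
  taylor : Series → ℕ → Carrier
  taylor f n = fromℕ (n !) * f n

  Invertible : Series → Set ℓ
  Invertible f = (f 0 ≈ 0#) × ¬ (f 1 ≈ 0#)

  -- Partial Bell polynomials, evaluated at a sequence X (X j = X_j, j ≥ 1;
  -- X 0 is never used):
  --   B_{n,k} = Σ n! / (k_1! k_2! ⋯) Π_j (X_j / j!)^{k_j}
  -- over (k_1, k_2, …) with Σ k_j = k, Σ j k_j = n.  Since j k_j ≤ n,
  -- only k_1..k_n can be nonzero and each k_j ≤ n, so we enumerate all
  -- vectors (k_1,…,k_n) ∈ {0..n}^n and keep those satisfying the constraints.

  range : ℕ → List ℕ
  range zero    = 0 ∷ []
  range (suc m) = range m ++ (suc m ∷ [])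

  vecs : (m len : ℕ) → List (Vec ℕ len)
  vecs m zero      = [] ∷ []
  vecs m (suc len) = concatMap (λ a → map (a ∷_) (vecs m len)) (range m)

  -- data of a multiplicity vector whose first entry is k_j:
  -- (Σ k_i, Σ i k_i, Π X_i^{k_i}, Π k_i! (i!)^{k_i})
  record Summary : Set c where
    constructor ⟨_,_,_,_⟩
    field
      cnt wt : ℕ
      mon    : Carrier
      den    : ℕ

  summary : (X : ℕ → Carrier) → (j : ℕ) → {len : ℕ} → Vec ℕ len → Summary
  summary X j []       = ⟨ 0 , 0 , 1# , 1 ⟩
  summary X j (kj ∷ ks) with summary X (suc j) ks
  ... | ⟨ c′ , w′ , m′ , d′ ⟩ =
    ⟨ kj ℕ+ c′ , j ℕ* kj ℕ+ w′ , (X j ^ kj) * m′ , ((kj !) ℕ* ((j !) Data.Nat.^ kj)) ℕ* d′ ⟩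

  bellTerm : (n k : ℕ) (X : ℕ → Carrier) → Vec ℕ n → Carrier
  bellTerm n k X ks with summary X 1 ks
  ... | ⟨ c′ , w′ , m′ , d′ ⟩ =
    if (c′ ≡ᵇ k) Data.Bool.∧ (w′ ≡ᵇ n)
      then fromℕ (n !) * m′ * (fromℕ d′ ⁻¹)
      else 0#

  B : (n k : ℕ) → (ℕ → Carrier) → Carrier
  B n k X = foldr _+_ 0# (map (bellTerm n k X) (vecs n n))

  -- A_{n,k} (1 ≤ k ≤ n), evaluated at X with X_1 ≠ 0: the unique solution of
  --   Σ_{j=k}^{n} A_{n,j} B_{j,k} = δ_{nk}   (1 ≤ k ≤ n),
  -- solved for k = n, n-1, …, 1 in turn:
  --   A_{n,k} = B_{k,k}^{-1} (δ_{nk} - Σ_{j=k+1}^{n} A_{n,j} B_{j,k}).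

  δ : ℕ → ℕ → Carrier
  δ n k = if n ≡ᵇ k then 1# else 0#

  -- row n d = [(n∸d, A_{n,n∸d}), …, (n, A_{n,n})]
  row : ℕ → (X : ℕ → Carrier) → ℕ → List (ℕ × Carrier)
  row n X zero    = (n , (B n n X ⁻¹) * δ n n) ∷ []
  row n X (suc d) =
    let k    = n ∸ suc d
        prev = row n X d
        s    = foldr (λ { (j , a) acc → a * B j k X + acc }) 0# prev
    in (k , (B k k X ⁻¹) * (δ n k - s)) ∷ prev

  headVal : List (ℕ × Carrier) → Carrier
  headVal []            = 0#
  headVal ((_ , a) ∷ _) = a

  A : (n k : ℕ) → (ℕ → Carrier) → Carrier
  A n k X = headVal (row n X (n ∸ k))

  L : (n k : ℕ) → (ℕ → Carrier) → Carrier
  L n k X = Σ[ k ⋯ n ] (λ j → ((- 1#) ^ j) * A n j X * B j k X)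

-- Let G = Σ gⱼ xʲ / j! and let H be its compositional inverse. Computing coefficients of powers
-- shows that Bₙ,ₖ(g) and Aₙ,ₖ(g) are the n-th Taylor coefficients of Gᵏ / k! and Hᵏ / k! (the system
-- defining A is (G ∘ H)ᵏ = xᵏ), so Lₙ,₁(g) = Σⱼ (-1)ʲ Aₙ,ⱼ gⱼ is the n-th Taylor coefficient of
-- G ∘ (-H). The condition on f therefore says f = G ∘ (-x) ∘ G⁻¹, and such conjugates of -x are
-- involutions. Conversely, if f ∘ f = x then φ = (x - f) / 2 satisfies φ ∘ f = -φ; since f ≠ x,
-- φ'(0) ≠ 0 (otherwise the coefficients of φ ∘ f = -φ force φ = 0 degree by degree), so
-- f = φ⁻¹ ∘ (-x) ∘ φ and g is the sequence of Taylor coefficients of φ⁻¹.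

module Submission where

open import Defs
open import Level using (Level; _⊔_)
open import Data.Nat using (ℕ; suc)
open import Data.Product using (Σ; _×_)
open import Function.Bundles using (_⇔_)
open import Relation.Nullary using (¬_)

open import Algebra.Bundles using (CommutativeSemiring; CommutativeMonoid)
import Algebra.Properties.CommutativeSemiring.Binomial as Binomial
import Algebra.Properties.CommutativeSemiring.Exp as CommutativeSemiringExp
import Algebra.Properties.Monoid.Mult as MonoidMult
import Algebra.Properties.Monoid.Sum as MonoidSum
import Algebra.Properties.Ring as RingProperties
import Algebra.Properties.Semiring.Exp as SemiringExp
import Algebra.Properties.Semiring.Mult as SemiringMult
import Algebra.Solver.Ring.NaturalCoefficients.Default as NaturalCoefficientsSolver
open import Data.Bool using (Bool; true; false; if_then_else_; _∧_)
open import Data.Bool.Properties using (∧-commutativeMonoid)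
open import Data.Empty using (⊥-elim)
open import Data.Fin as Fin using (Fin; toℕ)
open import Data.List using (List; []; _∷_; _++_; map; concatMap; foldr)
open import Data.List.Properties using (map-++; map-∘)
open import Data.Nat
  using (zero; _∸_; _≡ᵇ_; _≤ᵇ_; _≤_; _<_; z≤n; s≤s; _!; NonZero)
  renaming (_+_ to _ℕ+_; _*_ to _ℕ*_; _^_ to _ℕ^_)
open import Data.Nat.Combinatorics using (_C_; nCk≡n!/k![n-k]!; k![n∸k]!∣n!)
open import Data.Nat.DivMod using (m/n*n≡m)
open import Data.Nat.Properties as ℕ using (_!≢0; _!*_!≢0)
open import Data.Product using (_,_; proj₁; proj₂)
open import Data.Vec using (Vec; []; _∷_)
open import Function.Base using (_∘_)
open import Function.Bundles using (mk⇔)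
open import Relation.Nullary using (yes; no)
open import Relation.Nullary.Reflects using (Reflects; ofʸ; ofⁿ; fromEquivalence)
open import Relation.Binary.PropositionalEquality as ≡ using (_≡_)

open import Algebra.Properties.CommutativeSemigroup (CommutativeMonoid.commutativeSemigroup ∧-commutativeMonoid)
  using () renaming (interchange to ∧-interchange)

module PowerSeries {c ℓ} (F : Field c ℓ) where
  open Field F hiding (zero)
  open FieldTheory F
  open import Algebra.Definitions.RawSemiring (Algebra.Bundles.Semiring.rawSemiring semiring)
    using (_^_)
  open import Relation.Binary.Reasoning.Setoid setoid
  open RingProperties ring using (-1*x≈-x; -0#≈0#; -‿involutive; -‿distribˡ-*; -‿distribʳ-*; -‿+-comm; x∙y⁻¹≈ε⇒x≈y)
  open CommutativeSemiringExp commutativeSemiring using (^-distrib-*)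
  open SemiringExp semiring using (^-congˡ)
  open SemiringMult semiring using (×1-homo-*)
  module Solver = NaturalCoefficientsSolver commutativeSemiring
  open Solver using (_:+_; _:*_; _:=_)

  ≡ᵇ-reflects-≡ : ∀ m n → Reflects (m ≡ n) (m ≡ᵇ n)
  ≡ᵇ-reflects-≡ m n = fromEquivalence (ℕ.≡ᵇ⇒≡ m n) (ℕ.≡⇒≡ᵇ m n)

  ≡ᵇ-≡ : ∀ {m n m′ n′} → (m ≡ n → m′ ≡ n′) → (m′ ≡ n′ → m ≡ n) → (m ≡ᵇ n) ≡ (m′ ≡ᵇ n′)
  ≡ᵇ-≡ {m} {n} {m′} {n′} ⇒ ⇐ with m ≡ᵇ n | ≡ᵇ-reflects-≡ m n | m′ ≡ᵇ n′ | ≡ᵇ-reflects-≡ m′ n′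
  ... | true  | _       | true  | _         = ≡.refl
  ... | false | _       | false | _         = ≡.refl
  ... | true  | ofʸ m≡n | false | ofⁿ m′≢n′ = ⊥-elim (m′≢n′ (⇒ m≡n))
  ... | false | ofⁿ m≢n | true  | ofʸ m′≡n′ = ⊥-elim (m≢n (⇐ m′≡n′))

  +-≡ᵇ : ∀ x y z → (x ℕ+ y ≡ᵇ z) ≡ (x ≤ᵇ z) ∧ (y ≡ᵇ z ∸ x)
  +-≡ᵇ x y z with x ≤ᵇ z | ℕ.≤ᵇ-reflects-≤ x z
  ... | true  | ofʸ x≤z = ≡ᵇ-≡ {x ℕ+ y} {z} {y} {z ∸ x} (λ { ≡.refl → ≡.sym (ℕ.m+n∸m≡n x y) })
                               (λ { ≡.refl → ℕ.m+[n∸m]≡n x≤z })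
  ... | false | ofⁿ x≰z with x ℕ+ y ≡ᵇ z | ≡ᵇ-reflects-≡ (x ℕ+ y) z
  ...   | false | _          = ≡.refl
  ...   | true  | ofʸ ≡.refl = ⊥-elim (x≰z (ℕ.m≤m+n x y))

  onlyIf : Bool → Carrier → Carrier
  onlyIf b x = if b then x else 0#

  onlyIf-≡ᵇ-refl : ∀ n x → onlyIf (n ≡ᵇ n) x ≈ x
  onlyIf-≡ᵇ-refl n x with n ≡ᵇ n | ≡ᵇ-reflects-≡ n n
  ... | true  | _       = refl
  ... | false | ofⁿ n≢n = ⊥-elim (n≢n ≡.refl)

  onlyIf-≡ᵇ-≢ : ∀ {m n} x → ¬ (m ≡ n) → onlyIf (m ≡ᵇ n) x ≈ 0#
  onlyIf-≡ᵇ-≢ {m} {n} x m≢n with m ≡ᵇ n | ≡ᵇ-reflects-≡ m n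
  ... | false | _          = refl
  ... | true  | ofʸ ≡.refl = ⊥-elim (m≢n ≡.refl)

  onlyIf-cong : ∀ b {x y} → x ≈ y → onlyIf b x ≈ onlyIf b y
  onlyIf-cong true  x≈y = x≈y
  onlyIf-cong false x≈y = refl

  *-onlyIf : ∀ b a x → a * onlyIf b x ≈ onlyIf b (a * x)
  *-onlyIf true  a x = refl
  *-onlyIf false a x = zeroʳ a

  x⁻¹*x≈1 : ∀ {x} → ¬ (x ≈ 0#) → x ⁻¹ * x ≈ 1#
  x⁻¹*x≈1 {x} x≉0 = trans (*-comm _ _) (⁻¹-inverse x x≉0)

  *-cancelˡ : ∀ {x a b} → ¬ (x ≈ 0#) → x * a ≈ x * b → a ≈ b
  *-cancelˡ {x} {a} {b} x≉0 xa≈xb = begin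
    a                ≈⟨ *-identityˡ a ⟨
    1# * a           ≈⟨ *-congʳ (x⁻¹*x≈1 x≉0) ⟨
    (x ⁻¹ * x) * a   ≈⟨ *-assoc _ _ _ ⟩
    x ⁻¹ * (x * a)   ≈⟨ *-congˡ xa≈xb ⟩
    x ⁻¹ * (x * b)   ≈⟨ *-assoc _ _ _ ⟨
    (x ⁻¹ * x) * b   ≈⟨ *-congʳ (x⁻¹*x≈1 x≉0) ⟩
    1# * b           ≈⟨ *-identityˡ b ⟩
    b                ∎

  ⁻¹-unique : ∀ {x y} → ¬ (x ≈ 0#) → x * y ≈ 1# → y ≈ x ⁻¹
  ⁻¹-unique {x} x≉0 xy≈1 = *-cancelˡ x≉0 (trans xy≈1 (sym (⁻¹-inverse x x≉0)))

  *-nonzero : ∀ {x y} → ¬ (x ≈ 0#) → ¬ (y ≈ 0#) → ¬ (x * y ≈ 0#)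
  *-nonzero {x} {y} x≉0 y≉0 xy≈0 = y≉0 (*-cancelˡ x≉0 (trans xy≈0 (sym (zeroʳ x))))

  ⁻¹-nonzero : ∀ {x} → ¬ (x ≈ 0#) → ¬ (x ⁻¹ ≈ 0#)
  ⁻¹-nonzero {x} x≉0 x⁻¹≈0 =
    0≉1 (trans (sym (zeroʳ x)) (trans (*-congˡ (sym x⁻¹≈0)) (⁻¹-inverse x x≉0)))

  ⁻¹-cong : ∀ {x y} → ¬ (x ≈ 0#) → x ≈ y → x ⁻¹ ≈ y ⁻¹
  ⁻¹-cong {x} {y} x≉0 x≈y =
    sym (⁻¹-unique x≉0 (trans (*-congʳ x≈y) (⁻¹-inverse y (λ y≈0 → x≉0 (trans x≈y y≈0)))))

  ⁻¹-distrib-* : ∀ {x y} → ¬ (x ≈ 0#) → ¬ (y ≈ 0#) → (x * y) ⁻¹ ≈ x ⁻¹ * y ⁻¹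
  ⁻¹-distrib-* {x} {y} x≉0 y≉0 = sym (⁻¹-unique (*-nonzero x≉0 y≉0) (begin
    (x * y) * (x ⁻¹ * y ⁻¹)   ≈⟨ Solver.solve 4 (λ a b c d → (a :* b) :* (c :* d) := (a :* c) :* (b :* d))
                                   refl x y (x ⁻¹) (y ⁻¹) ⟩
    (x * x ⁻¹) * (y * y ⁻¹)   ≈⟨ *-cong (⁻¹-inverse x x≉0) (⁻¹-inverse y y≉0) ⟩
    1# * 1#                   ≈⟨ *-identityˡ 1# ⟩
    1#                        ∎))

  1⁻¹≈1 : 1# ⁻¹ ≈ 1#
  1⁻¹≈1 = sym (⁻¹-unique (λ 1≈0 → 0≉1 (sym 1≈0)) (*-identityˡ 1#))

  ^-nonzero : ∀ {x} n → ¬ (x ≈ 0#) → ¬ (x ^ n ≈ 0#)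
  ^-nonzero zero    x≉0 1≈0 = 0≉1 (sym 1≈0)
  ^-nonzero (suc n) x≉0     = *-nonzero x≉0 (^-nonzero n x≉0)

  ⁻¹-^ : ∀ {x} n → ¬ (x ≈ 0#) → (x ^ n) ⁻¹ ≈ (x ⁻¹) ^ n
  ⁻¹-^ zero    x≉0 = 1⁻¹≈1
  ⁻¹-^ (suc n) x≉0 = trans (⁻¹-distrib-* x≉0 (^-nonzero n x≉0)) (*-congˡ (⁻¹-^ n x≉0))

  1^n≈1 : ∀ n → 1# ^ n ≈ 1#
  1^n≈1 zero    = refl
  1^n≈1 (suc n) = trans (*-identityˡ _) (1^n≈1 n)

  x*b≈t⇒b⁻¹*t≈x : ∀ {x b t} → ¬ (b ≈ 0#) → x * b ≈ t → b ⁻¹ * t ≈ x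
  x*b≈t⇒b⁻¹*t≈x {x} {b} {t} b≉0 xb≈t = begin
    b ⁻¹ * t         ≈⟨ *-congˡ xb≈t ⟨
    b ⁻¹ * (x * b)   ≈⟨ Solver.solve 3 (λ a y z → a :* (y :* z) := y :* (z :* a)) refl (b ⁻¹) x b ⟩
    x * (b * b ⁻¹)   ≈⟨ *-congˡ (⁻¹-inverse b b≉0) ⟩
    x * 1#           ≈⟨ *-identityʳ x ⟩
    x                ∎

  a+b≈c⇒a≈c-b : ∀ {a b c} → a + b ≈ c → a ≈ c - b
  a+b≈c⇒a≈c-b {a} {b} {c} a+b≈c = begin
    a                ≈⟨ +-identityʳ a ⟨
    a + 0#           ≈⟨ +-congˡ (-‿inverseʳ b) ⟨
    a + (b - b)      ≈⟨ +-assoc _ _ _ ⟨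
    (a + b) - b      ≈⟨ +-congʳ a+b≈c ⟩
    c - b            ∎

  fromℕ-* : ∀ m n → fromℕ (m ℕ* n) ≈ fromℕ m * fromℕ n
  fromℕ-* = ×1-homo-*

  fromℕ-^ : ∀ m n → fromℕ (m ℕ^ n) ≈ fromℕ m ^ n
  fromℕ-^ m zero    = +-identityʳ 1#
  fromℕ-^ m (suc n) = trans (fromℕ-* m (m ℕ^ n)) (*-congˡ (fromℕ-^ m n))

  fromℕ1≈1 : fromℕ 1 ≈ 1#
  fromℕ1≈1 = +-identityʳ 1#

  sumFrom-cong-on : ∀ k l {f g : ℕ → Carrier} →
    (∀ i → k ≤ i → i < k ℕ+ l → f i ≈ g i) → sumFrom k l f ≈ sumFrom k l g
  sumFrom-cong-on k zero    f≈g = refl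
  sumFrom-cong-on k (suc l) f≈g =
    +-cong (f≈g k ℕ.≤-refl (ℕ.m<m+n k (s≤s z≤n)))
           (sumFrom-cong-on (suc k) l (λ i k<i i<k+1+l →
             f≈g i (ℕ.<⇒≤ k<i) (≡.subst (i <_) (≡.sym (ℕ.+-suc k l)) i<k+1+l)))

  sumFrom-cong : ∀ k l {f g : ℕ → Carrier} → (∀ i → f i ≈ g i) → sumFrom k l f ≈ sumFrom k l g
  sumFrom-cong k l f≈g = sumFrom-cong-on k l (λ i _ _ → f≈g i)

  sumFrom-0# : ∀ k l → sumFrom k l (λ _ → 0#) ≈ 0#
  sumFrom-0# k zero    = refl
  sumFrom-0# k (suc l) = trans (+-identityˡ _) (sumFrom-0# (suc k) l)

  sumFrom-≈0 : ∀ k l {f : ℕ → Carrier} →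
    (∀ i → k ≤ i → i < k ℕ+ l → f i ≈ 0#) → sumFrom k l f ≈ 0#
  sumFrom-≈0 k l f≈0 = trans (sumFrom-cong-on k l f≈0) (sumFrom-0# k l)

  sumFrom-+ : ∀ k l (f g : ℕ → Carrier) →
    sumFrom k l (λ i → f i + g i) ≈ sumFrom k l f + sumFrom k l g
  sumFrom-+ k zero    f g = sym (+-identityˡ 0#)
  sumFrom-+ k (suc l) f g = trans (+-congˡ (sumFrom-+ (suc k) l f g))
    (Solver.solve 4 (λ a b c d → (a :+ b) :+ (c :+ d) := (a :+ c) :+ (b :+ d)) refl
      (f k) (g k) (sumFrom (suc k) l f) (sumFrom (suc k) l g))

  sumFrom-*ˡ : ∀ k l a (f : ℕ → Carrier) → sumFrom k l (λ i → a * f i) ≈ a * sumFrom k l f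
  sumFrom-*ˡ k zero    a f = sym (zeroʳ a)
  sumFrom-*ˡ k (suc l) a f = trans (+-congˡ (sumFrom-*ˡ (suc k) l a f)) (sym (distribˡ _ _ _))

  sumFrom-*ʳ : ∀ k l a (f : ℕ → Carrier) → sumFrom k l (λ i → f i * a) ≈ sumFrom k l f * a
  sumFrom-*ʳ k l a f =
    trans (sumFrom-cong k l (λ i → *-comm (f i) a)) (trans (sumFrom-*ˡ k l a f) (*-comm _ _))

  sumFrom-neg : ∀ k l (f : ℕ → Carrier) → sumFrom k l (λ i → - f i) ≈ - sumFrom k l f
  sumFrom-neg k zero    f = sym -0#≈0#
  sumFrom-neg k (suc l) f = trans (+-congˡ (sumFrom-neg (suc k) l f)) (-‿+-comm (f k) _)

  sumFrom-shift : ∀ k l (f : ℕ → Carrier) → sumFrom (suc k) l f ≡ sumFrom k l (λ i → f (suc i))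
  sumFrom-shift k zero    f = ≡.refl
  sumFrom-shift k (suc l) f = ≡.cong (f (suc k) +_) (sumFrom-shift (suc k) l f)

  sumFrom-split : ∀ k l m (f : ℕ → Carrier) →
    sumFrom k (l ℕ+ m) f ≈ sumFrom k l f + sumFrom (k ℕ+ l) m f
  sumFrom-split k zero    m f =
    trans (reflexive (≡.cong (λ k′ → sumFrom k′ m f) (≡.sym (ℕ.+-identityʳ k)))) (sym (+-identityˡ _))
  sumFrom-split k (suc l) m f = begin
    f k + sumFrom (suc k) (l ℕ+ m) f
      ≈⟨ +-congˡ (sumFrom-split (suc k) l m f) ⟩
    f k + (sumFrom (suc k) l f + sumFrom (suc k ℕ+ l) m f)
      ≈⟨ +-assoc _ _ _ ⟨
    sumFrom k (suc l) f + sumFrom (suc k ℕ+ l) m f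
      ≡⟨ ≡.cong (λ k′ → sumFrom k (suc l) f + sumFrom k′ m f) (≡.sym (ℕ.+-suc k l)) ⟩
    sumFrom k (suc l) f + sumFrom (k ℕ+ suc l) m f ∎

  sumFrom-snoc : ∀ k l (f : ℕ → Carrier) → sumFrom k (suc l) f ≈ sumFrom k l f + f (k ℕ+ l)
  sumFrom-snoc k l f = begin
    sumFrom k (suc l) f                      ≡⟨ ≡.cong (λ m → sumFrom k m f) (ℕ.+-comm 1 l) ⟩
    sumFrom k (l ℕ+ 1) f                     ≈⟨ sumFrom-split k l 1 f ⟩
    sumFrom k l f + (f (k ℕ+ l) + 0#)        ≈⟨ +-congˡ (+-identityʳ _) ⟩
    sumFrom k l f + f (k ℕ+ l)               ∎

  sumFrom-extend : ∀ k l m (f : ℕ → Carrier) →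
    (∀ i → k ℕ+ l ≤ i → f i ≈ 0#) → sumFrom k (l ℕ+ m) f ≈ sumFrom k l f
  sumFrom-extend k l m f f≈0 = trans (sumFrom-split k l m f)
    (trans (+-congˡ (sumFrom-≈0 (k ℕ+ l) m (λ i k+l≤i _ → f≈0 i k+l≤i))) (+-identityʳ _))

  sumFrom-skip : ∀ k l (f : ℕ → Carrier) → (∀ i → i < k → f i ≈ 0#) → sumFrom 0 (k ℕ+ l) f ≈ sumFrom k l f
  sumFrom-skip k l f f≈0 = trans (sumFrom-split 0 k l f)
    (trans (+-congʳ (sumFrom-≈0 0 k (λ i _ i<k → f≈0 i i<k))) (+-identityˡ _))

  sumFrom-swap : ∀ k l k′ l′ (f : ℕ → ℕ → Carrier) →
    sumFrom k l (λ i → sumFrom k′ l′ (f i)) ≈ sumFrom k′ l′ (λ j → sumFrom k l (λ i → f i j))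
  sumFrom-swap k zero    k′ l′ f = sym (sumFrom-0# k′ l′)
  sumFrom-swap k (suc l) k′ l′ f =
    trans (+-congˡ (sumFrom-swap (suc k) l k′ l′ f)) (sym (sumFrom-+ k′ l′ (f k) _))

  sumFrom-single : ∀ k l p (f : ℕ → Carrier) → k ≤ p → p < k ℕ+ l →
    (∀ i → k ≤ i → i < k ℕ+ l → ¬ (i ≡ p) → f i ≈ 0#) → sumFrom k l f ≈ f p
  sumFrom-single k zero p f k≤p p<k+0 _ =
    ⊥-elim (ℕ.<⇒≱ (≡.subst (p <_) (ℕ.+-identityʳ k) p<k+0) k≤p)
  sumFrom-single k (suc l) p f k≤p p<k+1+l f≈0 with k ℕ.≟ p
  ... | yes ≡.refl =
    trans (+-congˡ (sumFrom-≈0 (suc k) l (λ i k<i i<k+1+l →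
      f≈0 i (ℕ.<⇒≤ k<i) (≡.subst (i <_) (≡.sym (ℕ.+-suc k l)) i<k+1+l) (ℕ.>⇒≢ k<i))))
    (+-identityʳ _)
  ... | no k≢p =
    trans (+-congʳ (f≈0 k ℕ.≤-refl (ℕ.m<m+n k (s≤s z≤n)) k≢p)) (trans (+-identityˡ _)
      (sumFrom-single (suc k) l p f (ℕ.≤∧≢⇒< k≤p k≢p) (≡.subst (p <_) (ℕ.+-suc k l) p<k+1+l)
        (λ i k<i i<k+1+l → f≈0 i (ℕ.<⇒≤ k<i) (≡.subst (i <_) (≡.sym (ℕ.+-suc k l)) i<k+1+l))))

  sumFrom-reverse : ∀ n (f : ℕ → Carrier) →
    sumFrom 0 (suc n) f ≈ sumFrom 0 (suc n) (λ i → f (n ∸ i))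
  sumFrom-reverse zero    f = refl
  sumFrom-reverse (suc n) f = begin
    f 0 + sumFrom 1 (suc n) f
      ≡⟨ ≡.cong (f 0 +_) (sumFrom-shift 0 (suc n) f) ⟩
    f 0 + sumFrom 0 (suc n) (λ i → f (suc i))
      ≈⟨ +-congˡ (sumFrom-reverse n (λ i → f (suc i))) ⟩
    f 0 + sumFrom 0 (suc n) (λ i → f (suc (n ∸ i)))
      ≈⟨ +-comm _ _ ⟩
    sumFrom 0 (suc n) (λ i → f (suc (n ∸ i))) + f 0
      ≈⟨ +-cong (sumFrom-cong-on 0 (suc n) (λ i _ i<1+n →
                   reflexive (≡.cong f (≡.sym (ℕ.+-∸-assoc 1 (ℕ.≤-pred i<1+n))))))
                (reflexive (≡.cong f (≡.sym (ℕ.n∸n≡0 (suc n))))) ⟩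
    sumFrom 0 (suc n) (λ i → f (suc n ∸ i)) + f (suc n ∸ suc n)
      ≈⟨ sumFrom-snoc 0 (suc n) (λ i → f (suc n ∸ i)) ⟨
    sumFrom 0 (suc (suc n)) (λ i → f (suc n ∸ i)) ∎

  sumFrom-triangle : ∀ n (f : ℕ → ℕ → Carrier) →
    sumFrom 0 (suc n) (λ i → sumFrom 0 (suc i) (f i)) ≈
    sumFrom 0 (suc n) (λ j → sumFrom 0 (suc (n ∸ j)) (λ l → f (j ℕ+ l) j))
  sumFrom-triangle zero    f = refl
  sumFrom-triangle (suc n) f = begin
    sumFrom 0 (suc (suc n)) (λ i → sumFrom 0 (suc i) (f i))
      ≈⟨ sumFrom-snoc 0 (suc n) _ ⟩
    sumFrom 0 (suc n) (λ i → sumFrom 0 (suc i) (f i)) + sumFrom 0 (suc (suc n)) (f (suc n))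
      ≈⟨ +-cong (sumFrom-triangle n f) (sumFrom-snoc 0 (suc n) (f (suc n))) ⟩
    sumFrom 0 (suc n) (column n) + (sumFrom 0 (suc n) (f (suc n)) + f (suc n) (suc n))
      ≈⟨ +-assoc _ _ _ ⟨
    (sumFrom 0 (suc n) (column n) + sumFrom 0 (suc n) (f (suc n))) + f (suc n) (suc n)
      ≈⟨ +-cong (sym (sumFrom-+ 0 (suc n) _ _)) corner ⟩
    sumFrom 0 (suc n) (λ j → column n j + f (suc n) j) + column (suc n) (suc n)
      ≈⟨ +-congʳ (sumFrom-cong-on 0 (suc n) (λ j _ j<1+n → extend-column j (ℕ.≤-pred j<1+n))) ⟩
    sumFrom 0 (suc n) (column (suc n)) + column (suc n) (suc n)
      ≈⟨ sumFrom-snoc 0 (suc n) (column (suc n)) ⟨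
    sumFrom 0 (suc (suc n)) (column (suc n)) ∎
    where
    column : ℕ → ℕ → Carrier
    column m j = sumFrom 0 (suc (m ∸ j)) (λ l → f (j ℕ+ l) j)

    corner : f (suc n) (suc n) ≈ column (suc n) (suc n)
    corner = begin
      f (suc n) (suc n)                     ≡⟨ ≡.cong (λ m → f m (suc n)) (ℕ.+-identityʳ (suc n)) ⟨
      f (suc n ℕ+ 0) (suc n)                ≈⟨ +-identityʳ _ ⟨
      f (suc n ℕ+ 0) (suc n) + 0#           ≡⟨ ≡.cong (λ m → sumFrom 0 (suc m) (λ l → f (suc n ℕ+ l) (suc n)))
                                                (ℕ.n∸n≡0 n) ⟨
      column (suc n) (suc n)                ∎

    extend-column : ∀ j → j ≤ n → column n j + f (suc n) j ≈ column (suc n) j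
    extend-column j j≤n = begin
      column n j + f (suc n) j
        ≡⟨ ≡.cong (λ m → column n j + f m j) j+[1+n∸j]≡1+n ⟨
      column n j + f (j ℕ+ suc (n ∸ j)) j
        ≈⟨ sumFrom-snoc 0 (suc (n ∸ j)) _ ⟨
      sumFrom 0 (suc (suc (n ∸ j))) (λ l → f (j ℕ+ l) j)
        ≡⟨ ≡.cong (λ m → sumFrom 0 (suc m) (λ l → f (j ℕ+ l) j)) (ℕ.+-∸-assoc 1 j≤n) ⟨
      column (suc n) j ∎
      where
      j+[1+n∸j]≡1+n : j ℕ+ suc (n ∸ j) ≡ suc n
      j+[1+n∸j]≡1+n = ≡.trans (ℕ.+-suc j (n ∸ j)) (≡.cong suc (ℕ.m+[n∸m]≡n j≤n))

  infix 4 _≋_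
  _≋_ : Series → Series → Set ℓ
  f ≋ g = ∀ n → f n ≈ g n

  ≋-refl : ∀ {f} → f ≋ f
  ≋-refl n = refl

  ≋-sym : ∀ {f g} → f ≋ g → g ≋ f
  ≋-sym f≋g n = sym (f≋g n)

  ≋-trans : ∀ {f g h} → f ≋ g → g ≋ h → f ≋ h
  ≋-trans f≋g g≋h n = trans (f≋g n) (g≋h n)

  zeroS : Series
  zeroS _ = 0#

  addS : Series → Series → Series
  addS f g n = f n + g n

  negS : Series → Series
  negS f n = - f n

  scaleS : Carrier → Series → Series
  scaleS a f n = a * f n

  mulS-cong : ∀ {f f′ g g′} → f ≋ f′ → g ≋ g′ → mulS f g ≋ mulS f′ g′
  mulS-cong f≋f′ g≋g′ n = sumFrom-cong 0 (suc n) (λ i → *-cong (f≋f′ i) (g≋g′ (n ∸ i)))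

  mulS-comm : ∀ f g → mulS f g ≋ mulS g f
  mulS-comm f g n = trans (sumFrom-reverse n _) (sumFrom-cong-on 0 (suc n) (λ i _ i<1+n →
    trans (*-comm _ _) (*-congʳ (reflexive (≡.cong g (ℕ.m∸[m∸n]≡n (ℕ.≤-pred i<1+n)))))))

  mulS-assoc : ∀ f g h → mulS (mulS f g) h ≋ mulS f (mulS g h)
  mulS-assoc f g h n = begin
    sumFrom 0 (suc n) (λ i → sumFrom 0 (suc i) (λ j → f j * g (i ∸ j)) * h (n ∸ i))
      ≈⟨ sumFrom-cong 0 (suc n) (λ i → sym (sumFrom-*ʳ 0 (suc i) (h (n ∸ i)) _)) ⟩
    sumFrom 0 (suc n) (λ i → sumFrom 0 (suc i) (λ j → f j * g (i ∸ j) * h (n ∸ i)))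
      ≈⟨ sumFrom-triangle n (λ i j → f j * g (i ∸ j) * h (n ∸ i)) ⟩
    sumFrom 0 (suc n) (λ j → sumFrom 0 (suc (n ∸ j)) (λ l → f j * g (j ℕ+ l ∸ j) * h (n ∸ (j ℕ+ l))))
      ≈⟨ sumFrom-cong 0 (suc n) (λ j → trans (sumFrom-cong 0 (suc (n ∸ j)) (λ l →
           trans (*-assoc _ _ _) (*-congˡ (*-cong (reflexive (≡.cong g (ℕ.m+n∸m≡n j l)))
                                                   (reflexive (≡.cong h (≡.sym (ℕ.∸-+-assoc n j l))))))))
           (sumFrom-*ˡ 0 (suc (n ∸ j)) (f j) _)) ⟩
    sumFrom 0 (suc n) (λ j → f j * sumFrom 0 (suc (n ∸ j)) (λ l → g l * h (n ∸ j ∸ l))) ∎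

  mulS-distribˡ : ∀ f g h → mulS f (addS g h) ≋ addS (mulS f g) (mulS f h)
  mulS-distribˡ f g h n =
    trans (sumFrom-cong 0 (suc n) (λ i → distribˡ _ _ _)) (sumFrom-+ 0 (suc n) _ _)

  mulS-identityˡ : ∀ f → mulS oneS f ≋ f
  mulS-identityˡ f n =
    trans (+-cong (*-identityˡ (f n)) (sumFrom-≈0 1 n higher)) (+-identityʳ _)
    where
    higher : ∀ i → 1 ≤ i → i < 1 ℕ+ n → oneS i * f (n ∸ i) ≈ 0#
    higher (suc i) _ _ = zeroˡ _

  mulS-identityʳ : ∀ f → mulS f oneS ≋ f
  mulS-identityʳ f = ≋-trans (mulS-comm f oneS) (mulS-identityˡ f)

  mulS-zeroˡ : ∀ f → mulS zeroS f ≋ zeroS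
  mulS-zeroˡ f n = sumFrom-≈0 0 (suc n) (λ i _ _ → zeroˡ _)

  seriesSemiring : CommutativeSemiring c ℓ
  seriesSemiring = record
    { Carrier = Series ; _≈_ = _≋_ ; _+_ = addS ; _*_ = mulS ; 0# = zeroS ; 1# = oneS
    ; isCommutativeSemiring = record
      { isSemiring = record
        { isSemiringWithoutAnnihilatingZero = record
          { +-isCommutativeMonoid = record
            { isMonoid = record
              { isSemigroup = record
                { isMagma = record
                  { isEquivalence = record { refl = ≋-refl ; sym = ≋-sym ; trans = ≋-trans }
                  ; ∙-cong = λ f≋f′ g≋g′ n → +-cong (f≋f′ n) (g≋g′ n) }
                ; assoc = λ f g h n → +-assoc (f n) (g n) (h n) }
              ; identity = (λ f n → +-identityˡ (f n)) , (λ f n → +-identityʳ (f n)) }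
            ; comm = λ f g n → +-comm (f n) (g n) }
          ; *-cong = mulS-cong
          ; *-assoc = mulS-assoc
          ; *-identity = mulS-identityˡ , mulS-identityʳ
          ; distrib = mulS-distribˡ , λ f g h →
              ≋-trans (mulS-comm (addS g h) f) (≋-trans (mulS-distribˡ f g h)
                (λ n → +-cong (mulS-comm f g n) (mulS-comm f h n))) }
        ; zero = mulS-zeroˡ , λ f → ≋-trans (mulS-comm f zeroS) (mulS-zeroˡ f) }
      ; *-comm = mulS-comm } }

  powS-cong : ∀ {f g} k → f ≋ g → powS f k ≋ powS g k
  powS-cong zero    f≋g = ≋-refl
  powS-cong (suc k) f≋g = mulS-cong f≋g (powS-cong k f≋g)

  powS-+ : ∀ f a b → powS f (a ℕ+ b) ≋ mulS (powS f a) (powS f b)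
  powS-+ f zero    b = ≋-sym (mulS-identityˡ _)
  powS-+ f (suc a) b = ≋-trans (mulS-cong ≋-refl (powS-+ f a b)) (≋-sym (mulS-assoc _ _ _))

  module SeriesExp = SemiringExp (CommutativeSemiring.semiring seriesSemiring)
  module SeriesMult = MonoidMult (CommutativeSemiring.+-monoid seriesSemiring)
  module SeriesSum = MonoidSum (CommutativeSemiring.+-monoid seriesSemiring)
  module SeriesBinomial = Binomial seriesSemiring

  ^≋powS : ∀ f k → f SeriesExp.^ k ≋ powS f k
  ^≋powS f zero    = ≋-refl
  ^≋powS f (suc k) = mulS-cong ≋-refl (^≋powS f k)

  ×≋scaleS-fromℕ : ∀ k f → k SeriesMult.× f ≋ scaleS (fromℕ k) f
  ×≋scaleS-fromℕ zero    f n = sym (zeroˡ _)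
  ×≋scaleS-fromℕ (suc k) f n =
    trans (+-cong (sym (*-identityˡ _)) (×≋scaleS-fromℕ k f n)) (sym (distribʳ _ _ _))

  sum≈sumFrom : ∀ m (fs : Fin m → Series) (φ : ℕ → Carrier) n →
    (∀ i → fs i n ≈ φ (toℕ i)) → SeriesSum.sum fs n ≈ sumFrom 0 m φ
  sum≈sumFrom zero    fs φ n fs≈φ = refl
  sum≈sumFrom (suc m) fs φ n fs≈φ = +-cong (fs≈φ Fin.zero)
    (trans (sum≈sumFrom m (fs ∘ Fin.suc) (φ ∘ suc) n (fs≈φ ∘ Fin.suc))
           (reflexive (≡.sym (sumFrom-shift 0 m φ))))

  powS-binomial : ∀ u v k n → powS (addS u v) k n ≈
    sumFrom 0 (suc k) (λ a → fromℕ (k C a) * mulS (powS u a) (powS v (k ∸ a)) n)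
  powS-binomial u v k n = begin
    powS (addS u v) k n                 ≈⟨ ^≋powS (addS u v) k n ⟨
    (addS u v SeriesExp.^ k) n          ≈⟨ SeriesBinomial.theorem k u v n ⟩
    SeriesBinomial.binomialExpansion u v k n
      ≈⟨ sum≈sumFrom (suc k) (SeriesBinomial.binomialTerm u v k) _ n (λ a →
           trans (×≋scaleS-fromℕ (k C toℕ a) (SeriesBinomial.binomial u v k a) n)
                 (*-congˡ (mulS-cong (^≋powS u (toℕ a)) (^≋powS v (k ∸ toℕ a)) n))) ⟩
    sumFrom 0 (suc k) (λ a → fromℕ (k C a) * mulS (powS u a) (powS v (k ∸ a)) n) ∎

  powS-negS : ∀ h j → powS (negS h) j ≋ scaleS ((- 1#) ^ j) (powS h j)
  powS-negS h zero    n = sym (*-identityˡ _)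
  powS-negS h (suc j) n = begin
    mulS (negS h) (powS (negS h) j) n
      ≈⟨ mulS-cong ≋-refl (powS-negS h j) n ⟩
    sumFrom 0 (suc n) (λ i → - h i * ((- 1#) ^ j * powS h j (n ∸ i)))
      ≈⟨ sumFrom-cong 0 (suc n) (λ i → trans (*-congʳ (sym (-1*x≈-x (h i))))
           (Solver.solve 4 (λ m₁ x mⱼ y → (m₁ :* x) :* (mⱼ :* y) := (m₁ :* mⱼ) :* (x :* y)) refl
             (- 1#) (h i) ((- 1#) ^ j) (powS h j (n ∸ i)))) ⟩
    sumFrom 0 (suc n) (λ i → (- 1# * (- 1#) ^ j) * (h i * powS h j (n ∸ i)))
      ≈⟨ sumFrom-*ˡ 0 (suc n) _ _ ⟩
    (- 1# * (- 1#) ^ j) * mulS h (powS h j) n ∎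

  AgreeUpTo : ℕ → Series → Series → Set ℓ
  AgreeUpTo n u v = ∀ i → i ≤ n → u i ≈ v i

  AgreeUpTo-mono : ∀ {m n u v} → m ≤ n → AgreeUpTo n u v → AgreeUpTo m u v
  AgreeUpTo-mono m≤n u≈v i i≤m = u≈v i (ℕ.≤-trans i≤m m≤n)

  powS-vanishes-below : ∀ u → u 0 ≈ 0# → ∀ k m → m < k → powS u k m ≈ 0#
  powS-vanishes-below u u₀≈0 (suc k) m (s≤s m≤k) = sumFrom-≈0 0 (suc m) term≈0
    where
    term≈0 : ∀ i → 0 ≤ i → i < suc m → u i * powS u k (m ∸ i) ≈ 0#
    term≈0 zero    _ _           = trans (*-congʳ u₀≈0) (zeroˡ _)
    term≈0 (suc i) _ (s≤s i<m) = trans (*-congˡ (powS-vanishes-below u u₀≈0 k (m ∸ suc i)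
      (ℕ.<-≤-trans (ℕ.∸-monoʳ-< {m} {suc i} {0} (s≤s z≤n) i<m) m≤k))) (zeroʳ _)

  powS-diagonal : ∀ u → u 0 ≈ 0# → ∀ k → powS u k k ≈ u 1 ^ k
  powS-diagonal u u₀≈0 zero    = refl
  powS-diagonal u u₀≈0 (suc k) =
    trans (sumFrom-single 0 (suc (suc k)) 1 _ z≤n (s≤s (s≤s z≤n)) term≈0)
          (*-congˡ (powS-diagonal u u₀≈0 k))
    where
    term≈0 : ∀ i → 0 ≤ i → i < suc (suc k) → ¬ (i ≡ 1) → u i * powS u k (suc k ∸ i) ≈ 0#
    term≈0 zero          _ _                 _   = trans (*-congʳ u₀≈0) (zeroˡ _)
    term≈0 (suc zero)    _ _                 i≢1 = ⊥-elim (i≢1 ≡.refl)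
    term≈0 (suc (suc i)) _ (s≤s (s≤s i≤k)) _ = trans (*-congˡ (powS-vanishes-below u u₀≈0 k (k ∸ suc i)
      (ℕ.∸-monoʳ-< {k} {suc i} {0} (s≤s z≤n) i≤k))) (zeroʳ _)

  mulS-agree : ∀ n {u u′ v v′} → AgreeUpTo n u u′ → AgreeUpTo n v v′ →
    AgreeUpTo n (mulS u v) (mulS u′ v′)
  mulS-agree n u≈u′ v≈v′ m m≤n = sumFrom-cong-on 0 (suc m) (λ i _ i<1+m →
    *-cong (u≈u′ i (ℕ.≤-trans (ℕ.≤-pred i<1+m) m≤n)) (v≈v′ (m ∸ i) (ℕ.≤-trans (ℕ.m∸n≤m m i) m≤n)))

  powS-agree : ∀ n {u v} k → AgreeUpTo n u v → AgreeUpTo n (powS u k) (powS v k)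
  powS-agree n zero    u≈v i _ = refl
  powS-agree n (suc k) u≈v     = mulS-agree n u≈v (powS-agree n k u≈v)

  -- The one coefficient of degree n + 1 involved, u (n + 1), meets the constant term of u ^ (k + 1),
  -- which is 0.
  powS-agree-next : ∀ n {u v} → u 0 ≈ 0# → v 0 ≈ 0# → AgreeUpTo n u v →
    ∀ k → powS u (suc (suc k)) (suc n) ≈ powS v (suc (suc k)) (suc n)
  powS-agree-next n {u} {v} u₀≈0 v₀≈0 u≈v k = sumFrom-cong-on 0 (suc (suc n)) term≈term
    where
    term≈term : ∀ i → 0 ≤ i → i < suc (suc n) →
      u i * powS u (suc k) (suc n ∸ i) ≈ v i * powS v (suc k) (suc n ∸ i)
    term≈term zero _ _ = trans (*-congʳ u₀≈0) (trans (zeroˡ _) (sym (trans (*-congʳ v₀≈0) (zeroˡ _))))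
    term≈term (suc i) _ (s≤s i≤n) with suc i ℕ.≤? n
    ... | yes 1+i≤n = *-cong (u≈v (suc i) 1+i≤n) (powS-agree n (suc k) u≈v (n ∸ i) (ℕ.m∸n≤m n i))
    ... | no  1+i≰n =
      trans (*-congˡ (vanishes u u₀≈0)) (trans (zeroʳ _) (sym (trans (*-congˡ (vanishes v v₀≈0)) (zeroʳ _))))
      where
      n∸i≡0 : n ∸ i ≡ 0
      n∸i≡0 = ℕ.m≤n⇒m∸n≡0 (ℕ.≤-pred (ℕ.≰⇒> 1+i≰n))
      vanishes : ∀ w → w 0 ≈ 0# → powS w (suc k) (n ∸ i) ≈ 0#
      vanishes w w₀≈0 = trans (reflexive (≡.cong (powS w (suc k)) n∸i≡0))
                              (powS-vanishes-below w w₀≈0 (suc k) 0 (s≤s z≤n))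

  compS-congˡ : ∀ {f f′} g → f ≋ f′ → compS f g ≋ compS f′ g
  compS-congˡ g f≋f′ n = sumFrom-cong 0 (suc n) (λ k → *-congʳ (f≋f′ k))

  compS-congʳ : ∀ f {g g′} → g ≋ g′ → compS f g ≋ compS f g′
  compS-congʳ f g≋g′ n = sumFrom-cong 0 (suc n) (λ k → *-congˡ (powS-cong k g≋g′ n))

  compS-cong : ∀ {f f′ g g′} → f ≋ f′ → g ≋ g′ → compS f g ≋ compS f′ g′
  compS-cong {f′ = f′} {g} f≋f′ g≋g′ = ≋-trans (compS-congˡ g f≋f′) (compS-congʳ f′ g≋g′)

  compS-constant : ∀ f g → compS f g 0 ≈ f 0
  compS-constant f g = trans (+-identityʳ _) (*-identityʳ _)

  compS-linear : ∀ f g → compS f g 1 ≈ f 1 * g 1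
  compS-linear f g = trans (+-congʳ (zeroʳ (f 0))) (trans (+-identityˡ _)
    (trans (+-identityʳ _) (*-congˡ (mulS-identityʳ g 1))))

  compS-truncate : ∀ f g → g 0 ≈ 0# → ∀ n N → n ≤ N →
    compS f g n ≈ sumFrom 0 (suc N) (λ k → f k * powS g k n)
  compS-truncate f g g₀≈0 n N n≤N = sym (begin
    sumFrom 0 (suc N) (λ k → f k * powS g k n)
      ≡⟨ ≡.cong (λ m → sumFrom 0 m (λ k → f k * powS g k n)) (≡.cong suc (ℕ.m+[n∸m]≡n n≤N)) ⟨
    sumFrom 0 (suc n ℕ+ (N ∸ n)) (λ k → f k * powS g k n)
      ≈⟨ sumFrom-extend 0 (suc n) (N ∸ n) _ (λ k n<k →
           trans (*-congˡ (powS-vanishes-below g g₀≈0 k n n<k)) (zeroʳ _)) ⟩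
    compS f g n ∎)

  compS-addˡ : ∀ f f′ g → compS (addS f f′) g ≋ addS (compS f g) (compS f′ g)
  compS-addˡ f f′ g n = trans (sumFrom-cong 0 (suc n) (λ k → distribʳ _ _ _)) (sumFrom-+ 0 (suc n) _ _)

  compS-scaleˡ : ∀ a f g → compS (scaleS a f) g ≋ scaleS a (compS f g)
  compS-scaleˡ a f g n = trans (sumFrom-cong 0 (suc n) (λ k → *-assoc _ _ _)) (sumFrom-*ˡ 0 (suc n) a _)

  compS-negˡ : ∀ f g → compS (negS f) g ≋ negS (compS f g)
  compS-negˡ f g n =
    trans (sumFrom-cong 0 (suc n) (λ k → sym (-‿distribˡ-* _ _))) (sumFrom-neg 0 (suc n) _)

  compS-oneˡ : ∀ g → compS oneS g ≋ oneS
  compS-oneˡ g n = trans (+-cong (*-identityˡ _) (sumFrom-≈0 1 n higher)) (+-identityʳ _)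
    where
    higher : ∀ i → 1 ≤ i → i < 1 ℕ+ n → oneS i * powS g i n ≈ 0#
    higher (suc i) _ _ = zeroˡ _

  mulS-idˡ : ∀ g n → mulS idS g (suc n) ≈ g n
  mulS-idˡ g n = trans (sumFrom-single 0 (suc (suc n)) 1 _ z≤n (s≤s (s≤s z≤n)) term≈0) (*-identityˡ _)
    where
    term≈0 : ∀ i → 0 ≤ i → i < suc (suc n) → ¬ (i ≡ 1) → idS i * g (suc n ∸ i) ≈ 0#
    term≈0 zero          _ _ _   = zeroˡ _
    term≈0 (suc zero)    _ _ i≢1 = ⊥-elim (i≢1 ≡.refl)
    term≈0 (suc (suc i)) _ _ _   = zeroˡ _

  compS-idˡ : ∀ g → g 0 ≈ 0# → compS idS g ≋ g
  compS-idˡ g g₀≈0 zero    = trans (+-identityʳ _) (trans (zeroˡ _) (sym g₀≈0))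
  compS-idˡ g g₀≈0 (suc n) =
    trans (sumFrom-single 0 (suc (suc n)) 1 _ z≤n (s≤s (s≤s z≤n)) term≈0)
          (trans (*-identityˡ _) (mulS-identityʳ g (suc n)))
    where
    term≈0 : ∀ i → 0 ≤ i → i < suc (suc n) → ¬ (i ≡ 1) → idS i * powS g i (suc n) ≈ 0#
    term≈0 zero          _ _ _   = zeroˡ _
    term≈0 (suc zero)    _ _ i≢1 = ⊥-elim (i≢1 ≡.refl)
    term≈0 (suc (suc i)) _ _ _   = zeroˡ _

  powS-idS : ∀ k n → powS idS k n ≈ δ n k
  powS-idS zero    n       = refl
  powS-idS (suc k) zero    = trans (+-identityʳ _) (zeroˡ _)
  powS-idS (suc k) (suc n) = trans (mulS-idˡ (powS idS k) n) (powS-idS k n)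

  compS-idʳ : ∀ f → compS f idS ≋ f
  compS-idʳ f n =
    trans (sumFrom-single 0 (suc n) n _ z≤n (ℕ.n<1+n n) term≈0)
          (trans (*-congˡ (trans (powS-idS n n) (onlyIf-≡ᵇ-refl n 1#))) (*-identityʳ _))
    where
    term≈0 : ∀ i → 0 ≤ i → i < suc n → ¬ (i ≡ n) → f i * powS idS i n ≈ 0#
    term≈0 i _ _ i≢n = trans (*-congˡ (trans (powS-idS i n) (onlyIf-≡ᵇ-≢ 1# (i≢n ∘ ≡.sym)))) (zeroʳ _)

  compS-mulS-expand : ∀ f f′ g → g 0 ≈ 0# → ∀ n →
    compS (mulS f f′) g n ≈
    sumFrom 0 (suc n) (λ i → sumFrom 0 (suc n) (λ j → (f i * f′ j) * powS g (i ℕ+ j) n))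
  compS-mulS-expand f f′ g g₀≈0 n = begin
    sumFrom 0 (suc n) (λ k → mulS f f′ k * powS g k n)
      ≈⟨ sumFrom-cong 0 (suc n) (λ k → sym (sumFrom-*ʳ 0 (suc k) (powS g k n) _)) ⟩
    sumFrom 0 (suc n) (λ k → sumFrom 0 (suc k) (λ i → f i * f′ (k ∸ i) * powS g k n))
      ≈⟨ sumFrom-triangle n (λ k i → f i * f′ (k ∸ i) * powS g k n) ⟩
    sumFrom 0 (suc n) (λ i → sumFrom 0 (suc (n ∸ i)) (λ j → f i * f′ (i ℕ+ j ∸ i) * powS g (i ℕ+ j) n))
      ≈⟨ sumFrom-cong-on 0 (suc n) (λ i _ i<1+n → trans
           (sumFrom-cong 0 (suc (n ∸ i)) (λ j → *-congʳ (*-congˡ (reflexive (≡.cong f′ (ℕ.m+n∸m≡n i j))))))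
           (extend i (ℕ.≤-pred i<1+n))) ⟩
    sumFrom 0 (suc n) (λ i → sumFrom 0 (suc n) (term i)) ∎
    where
    term : ℕ → ℕ → Carrier
    term i j = (f i * f′ j) * powS g (i ℕ+ j) n
    extend : ∀ i → i ≤ n → sumFrom 0 (suc (n ∸ i)) (term i) ≈ sumFrom 0 (suc n) (term i)
    extend i i≤n = sym (trans
      (reflexive (≡.cong (λ m → sumFrom 0 m (term i)) (≡.cong suc (≡.sym (ℕ.m∸n+n≡m i≤n)))))
      (sumFrom-extend 0 (suc (n ∸ i)) i (term i) (λ j n∸i<j →
        trans (*-congˡ (powS-vanishes-below g g₀≈0 (i ℕ+ j) n
          (≡.subst (_< i ℕ+ j) (ℕ.m+[n∸m]≡n i≤n) (ℕ.+-monoʳ-< i n∸i<j)))) (zeroʳ _))))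

  mulS-compS-expand : ∀ f f′ g → g 0 ≈ 0# → ∀ n →
    mulS (compS f g) (compS f′ g) n ≈
    sumFrom 0 (suc n) (λ i → sumFrom 0 (suc n) (λ j → (f i * f′ j) * powS g (i ℕ+ j) n))
  mulS-compS-expand f f′ g g₀≈0 n = begin
    sumFrom 0 (suc n) (λ a → compS f g a * compS f′ g (n ∸ a))
      ≈⟨ sumFrom-cong-on 0 (suc n) (λ a _ a<1+n →
           *-cong (compS-truncate f g g₀≈0 a n (ℕ.≤-pred a<1+n))
                  (compS-truncate f′ g g₀≈0 (n ∸ a) n (ℕ.m∸n≤m n a))) ⟩
    sumFrom 0 (suc n) (λ a → sumFrom 0 (suc n) (λ i → f i * powS g i a) *
                             sumFrom 0 (suc n) (λ j → f′ j * powS g j (n ∸ a)))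
      ≈⟨ sumFrom-cong 0 (suc n) (λ a → trans (sym (sumFrom-*ʳ 0 (suc n) _ _))
           (sumFrom-cong 0 (suc n) (λ i → sym (sumFrom-*ˡ 0 (suc n) _ _)))) ⟩
    sumFrom 0 (suc n) (λ a → sumFrom 0 (suc n) (λ i → sumFrom 0 (suc n) (λ j → term a i j)))
      ≈⟨ sumFrom-swap 0 (suc n) 0 (suc n) _ ⟩
    sumFrom 0 (suc n) (λ i → sumFrom 0 (suc n) (λ a → sumFrom 0 (suc n) (λ j → term a i j)))
      ≈⟨ sumFrom-cong 0 (suc n) (λ i → sumFrom-swap 0 (suc n) 0 (suc n) _) ⟩
    sumFrom 0 (suc n) (λ i → sumFrom 0 (suc n) (λ j → sumFrom 0 (suc n) (λ a → term a i j)))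
      ≈⟨ sumFrom-cong 0 (suc n) (λ i → sumFrom-cong 0 (suc n) (λ j → collect i j)) ⟩
    sumFrom 0 (suc n) (λ i → sumFrom 0 (suc n) (λ j → (f i * f′ j) * powS g (i ℕ+ j) n)) ∎
    where
    term : ℕ → ℕ → ℕ → Carrier
    term a i j = (f i * powS g i a) * (f′ j * powS g j (n ∸ a))
    collect : ∀ i j → sumFrom 0 (suc n) (λ a → term a i j) ≈ (f i * f′ j) * powS g (i ℕ+ j) n
    collect i j = begin
      sumFrom 0 (suc n) (λ a → term a i j)
        ≈⟨ sumFrom-cong 0 (suc n) (λ a → Solver.solve 4 (λ x y z w → (x :* y) :* (z :* w) := (x :* z) :* (y :* w))
             refl (f i) (powS g i a) (f′ j) (powS g j (n ∸ a))) ⟩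
      sumFrom 0 (suc n) (λ a → (f i * f′ j) * (powS g i a * powS g j (n ∸ a)))
        ≈⟨ sumFrom-*ˡ 0 (suc n) _ _ ⟩
      (f i * f′ j) * mulS (powS g i) (powS g j) n
        ≈⟨ *-congˡ (powS-+ g i j n) ⟨
      (f i * f′ j) * powS g (i ℕ+ j) n ∎

  compS-mulS : ∀ f f′ g → g 0 ≈ 0# → compS (mulS f f′) g ≋ mulS (compS f g) (compS f′ g)
  compS-mulS f f′ g g₀≈0 n = trans (compS-mulS-expand f f′ g g₀≈0 n) (sym (mulS-compS-expand f f′ g g₀≈0 n))

  compS-powS : ∀ f g → g 0 ≈ 0# → ∀ k → compS (powS f k) g ≋ powS (compS f g) k
  compS-powS f g g₀≈0 zero    = compS-oneˡ g
  compS-powS f g g₀≈0 (suc k) =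
    ≋-trans (compS-mulS f (powS f k) g g₀≈0) (mulS-cong ≋-refl (compS-powS f g g₀≈0 k))

  compS-assoc : ∀ f g h → g 0 ≈ 0# → h 0 ≈ 0# → compS (compS f g) h ≋ compS f (compS g h)
  compS-assoc f g h g₀≈0 h₀≈0 n = begin
    sumFrom 0 (suc n) (λ k → compS f g k * powS h k n)
      ≈⟨ sumFrom-cong-on 0 (suc n) (λ k _ k<1+n → *-congʳ (compS-truncate f g g₀≈0 k n (ℕ.≤-pred k<1+n))) ⟩
    sumFrom 0 (suc n) (λ k → sumFrom 0 (suc n) (λ j → f j * powS g j k) * powS h k n)
      ≈⟨ sumFrom-cong 0 (suc n) (λ k → trans (sym (sumFrom-*ʳ 0 (suc n) _ _))
           (sumFrom-cong 0 (suc n) (λ j → *-assoc _ _ _))) ⟩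
    sumFrom 0 (suc n) (λ k → sumFrom 0 (suc n) (λ j → f j * (powS g j k * powS h k n)))
      ≈⟨ sumFrom-swap 0 (suc n) 0 (suc n) _ ⟩
    sumFrom 0 (suc n) (λ j → sumFrom 0 (suc n) (λ k → f j * (powS g j k * powS h k n)))
      ≈⟨ sumFrom-cong 0 (suc n) (λ j → trans (sumFrom-*ˡ 0 (suc n) _ _) (*-congˡ (compS-powS g h h₀≈0 j n))) ⟩
    sumFrom 0 (suc n) (λ j → f j * powS (compS g h) j n) ∎

  RightInverseOf : Series → Series → Set ℓ
  RightInverseOf g h = (h 0 ≈ 0#) × ¬ (h 1 ≈ 0#) × (compS g h ≋ idS)

  -- h is the fixed point of w ↦ g₁⁻¹ (x - ĝ ∘ w), with ĝ = g - g₁ x the nonlinear part of g.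
  -- This map gains one correct coefficient per step, so h n is read off after n + 1 steps.
  module RightInverseConstruction (g : Series) (g₀≈0 : g 0 ≈ 0#) (g₁≉0 : ¬ (g 1 ≈ 0#)) where

    nonlinear : Series
    nonlinear k = g k - g 1 * idS k

    nonlinear₀≈0 : nonlinear 0 ≈ 0#
    nonlinear₀≈0 = trans (+-cong g₀≈0 (trans (-‿cong (zeroʳ _)) -0#≈0#)) (+-identityˡ _)

    nonlinear₁≈0 : nonlinear 1 ≈ 0#
    nonlinear₁≈0 = trans (+-congˡ (-‿cong (*-identityʳ _))) (-‿inverseʳ _)

    step : Series → Series
    step w n = g 1 ⁻¹ * (idS n - compS nonlinear w n)

    step₀≈0 : ∀ w → step w 0 ≈ 0#
    step₀≈0 w = trans (*-congˡ (trans (+-identityˡ _)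
      (trans (-‿cong (trans (compS-constant nonlinear w) nonlinear₀≈0)) -0#≈0#))) (zeroʳ _)

    approx : ℕ → Series
    approx zero    = zeroS
    approx (suc n) = step (approx n)

    approx₀≈0 : ∀ n → approx n 0 ≈ 0#
    approx₀≈0 zero    = refl
    approx₀≈0 (suc n) = step₀≈0 (approx n)

    inverse : Series
    inverse i = approx (suc i) i

    inverse₀≈0 : inverse 0 ≈ 0#
    inverse₀≈0 = approx₀≈0 1

    compS-nonlinear-agree : ∀ n {w w′} → w 0 ≈ 0# → w′ 0 ≈ 0# → AgreeUpTo n w w′ →
      compS nonlinear w (suc n) ≈ compS nonlinear w′ (suc n)
    compS-nonlinear-agree n {w} {w′} w₀≈0 w′₀≈0 w≈w′ = sumFrom-cong 0 (suc (suc n)) term≈term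
      where
      vanish : ∀ {k} → nonlinear k ≈ 0# → ∀ u → nonlinear k * u ≈ 0#
      vanish nonlinearₖ≈0 u = trans (*-congʳ nonlinearₖ≈0) (zeroˡ u)
      term≈term : ∀ k → nonlinear k * powS w k (suc n) ≈ nonlinear k * powS w′ k (suc n)
      term≈term zero          = trans (vanish nonlinear₀≈0 _) (sym (vanish nonlinear₀≈0 _))
      term≈term (suc zero)    = trans (vanish nonlinear₁≈0 _) (sym (vanish nonlinear₁≈0 _))
      term≈term (suc (suc k)) = *-congˡ (powS-agree-next n w₀≈0 w′₀≈0 w≈w′ k)

    step-agree : ∀ n {w w′} → w 0 ≈ 0# → w′ 0 ≈ 0# → AgreeUpTo n w w′ →
      AgreeUpTo (suc n) (step w) (step w′)
    step-agree n {w} {w′} w₀≈0 w′₀≈0 w≈w′ zero    _           = trans (step₀≈0 w) (sym (step₀≈0 w′))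
    step-agree n {w} {w′} w₀≈0 w′₀≈0 w≈w′ (suc i) (s≤s i≤n) =
      *-congˡ (+-congˡ (-‿cong (compS-nonlinear-agree i w₀≈0 w′₀≈0 (AgreeUpTo-mono i≤n w≈w′))))

    approx-agree-next : ∀ n → AgreeUpTo n (approx (suc n)) (approx (suc (suc n)))
    approx-agree-next zero    zero _ = trans (approx₀≈0 1) (sym (approx₀≈0 2))
    approx-agree-next (suc n) =
      step-agree n (approx₀≈0 (suc n)) (approx₀≈0 (suc (suc n))) (approx-agree-next n)

    approx-agree : ∀ n m → AgreeUpTo n (approx (suc n)) (approx (suc n ℕ+ m))
    approx-agree n zero    i _   rewrite ℕ.+-identityʳ n = refl
    approx-agree n (suc m) i i≤n rewrite ℕ.+-suc n m =
      trans (approx-agree n m i i≤n) (approx-agree-next (n ℕ+ m) i (ℕ.≤-trans i≤n (ℕ.m≤m+n n m)))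

    inverse-agree : ∀ n → AgreeUpTo n inverse (approx (suc n))
    inverse-agree n i i≤n =
      ≡.subst (λ m → approx (suc i) i ≈ approx (suc m) i) (ℕ.m+[n∸m]≡n i≤n) (approx-agree i (n ∸ i) i ℕ.≤-refl)

    step-inverse : step inverse ≋ inverse
    step-inverse n = trans (step-agree n inverse₀≈0 (approx₀≈0 (suc n)) (inverse-agree n) n (ℕ.n≤1+n n))
                           (sym (approx-agree-next n n ℕ.≤-refl))

    compS-inverse : compS g inverse ≋ idS
    compS-inverse n = begin
      compS g inverse n
        ≈⟨ compS-congˡ inverse g≋nonlinear+linear n ⟩
      compS (addS nonlinear (scaleS (g 1) idS)) inverse n
        ≈⟨ compS-addˡ nonlinear _ inverse n ⟩
      compS nonlinear inverse n + compS (scaleS (g 1) idS) inverse n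
        ≈⟨ +-congˡ (trans (compS-scaleˡ (g 1) idS inverse n) (*-congˡ (compS-idˡ inverse inverse₀≈0 n))) ⟩
      compS nonlinear inverse n + g 1 * inverse n
        ≈⟨ +-congˡ (*-congˡ (step-inverse n)) ⟨
      compS nonlinear inverse n + g 1 * (g 1 ⁻¹ * (idS n - compS nonlinear inverse n))
        ≈⟨ +-congˡ (trans (sym (*-assoc _ _ _)) (trans (*-congʳ (⁻¹-inverse (g 1) g₁≉0)) (*-identityˡ _))) ⟩
      compS nonlinear inverse n + (idS n - compS nonlinear inverse n)
        ≈⟨ Solver.solve 3 (λ a b d → a :+ (b :+ d) := b :+ (a :+ d)) refl
             (compS nonlinear inverse n) (idS n) (- compS nonlinear inverse n) ⟩
      idS n + (compS nonlinear inverse n - compS nonlinear inverse n)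
        ≈⟨ +-congˡ (-‿inverseʳ _) ⟩
      idS n + 0#
        ≈⟨ +-identityʳ _ ⟩
      idS n ∎
      where
      g≋nonlinear+linear : g ≋ addS nonlinear (scaleS (g 1) idS)
      g≋nonlinear+linear k = sym (trans (+-assoc _ _ _) (trans (+-congˡ (-‿inverseˡ _)) (+-identityʳ _)))

  compS-id⇒linear≉0 : ∀ g h → compS g h ≋ idS → ¬ (h 1 ≈ 0#)
  compS-id⇒linear≉0 g h g∘h≋id h₁≈0 = 0≉1 (begin
    0#             ≈⟨ zeroʳ _ ⟨
    g 1 * 0#       ≈⟨ *-congˡ h₁≈0 ⟨
    g 1 * h 1      ≈⟨ compS-linear g h ⟨
    compS g h 1    ≈⟨ g∘h≋id 1 ⟩
    1#             ∎)

  rightInverse : ∀ g → g 0 ≈ 0# → ¬ (g 1 ≈ 0#) → Σ Series (RightInverseOf g)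
  rightInverse g g₀≈0 g₁≉0 = inverse , inverse₀≈0 , compS-id⇒linear≉0 g inverse compS-inverse , compS-inverse
    where open RightInverseConstruction g g₀≈0 g₁≉0

  rightInverse⇒leftInverse : ∀ g h → g 0 ≈ 0# → RightInverseOf g h → compS h g ≋ idS
  rightInverse⇒leftInverse g h g₀≈0 (h₀≈0 , h₁≉0 , g∘h≋id) = viaRightInverse (rightInverse h h₀≈0 h₁≉0)
    where
    -- h has a right inverse k too, and g = g ∘ (h ∘ k) = (g ∘ h) ∘ k = k.
    viaRightInverse : Σ Series (RightInverseOf h) → compS h g ≋ idS
    viaRightInverse (k , k₀≈0 , _ , h∘k≋id) = ≋-trans (compS-congʳ h g≋k) h∘k≋id
      where
      g≋k : g ≋ k
      g≋k = ≋-trans (≋-sym (compS-idʳ g)) (≋-trans (compS-congʳ g (≋-sym h∘k≋id))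
             (≋-trans (≋-sym (compS-assoc g h k h₀≈0 k₀≈0)) (≋-trans (compS-congˡ k g∘h≋id) (compS-idˡ k k₀≈0))))

  record NegationConjugate (f : Series) : Set (c ⊔ ℓ) where
    field
      g h       : Series
      g₀≈0      : g 0 ≈ 0#
      g₁≉0      : ¬ (g 1 ≈ 0#)
      h-inverse : RightInverseOf g h
      f≋g∘-h    : f ≋ compS g (negS h)

  -- g ∘ (-h) ∘ g ∘ (-h) = g ∘ (-(h ∘ g)) ∘ (-h) = g ∘ (-(-h)) = g ∘ h.
  NegationConjugate⇒involutory : ∀ {f} → NegationConjugate f → compS f f ≋ idS
  NegationConjugate⇒involutory record { g = g ; h = h ; g₀≈0 = g₀≈0 ; f≋g∘-h = f≋g∘-h
                                      ; h-inverse = h-inverse@(h₀≈0 , _ , g∘h≋id) } =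
    ≋-trans (compS-cong f≋g∘-h f≋g∘-h)
      (≋-trans (compS-assoc g (negS h) φ -h₀≈0 φ₀≈0) (≋-trans (compS-congʳ g -h∘φ≋h) g∘h≋id))
    where
    φ : Series
    φ = compS g (negS h)
    -h₀≈0 : negS h 0 ≈ 0#
    -h₀≈0 = trans (-‿cong h₀≈0) -0#≈0#
    φ₀≈0 : φ 0 ≈ 0#
    φ₀≈0 = trans (compS-constant g (negS h)) g₀≈0
    h∘g≋id : compS h g ≋ idS
    h∘g≋id = rightInverse⇒leftInverse g h g₀≈0 h-inverse
    -h∘φ≋h : compS (negS h) φ ≋ h
    -h∘φ≋h = ≋-trans (≋-sym (compS-assoc (negS h) g (negS h) g₀≈0 -h₀≈0))
      (≋-trans (compS-congˡ (negS h) (≋-trans (compS-negˡ h g) (λ n → -‿cong (h∘g≋id n))))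
      (≋-trans (compS-negˡ idS (negS h)) (λ n → trans (-‿cong (compS-idˡ (negS h) -h₀≈0 n)) (-‿involutive (h n)))))

  -- f = (k ∘ φ) ∘ f = k ∘ (φ ∘ f) = k ∘ (-φ).
  anticommuting⇒conjugate-negS : ∀ f φ k → f 0 ≈ 0# → φ 0 ≈ 0# →
    compS k φ ≋ idS → compS φ f ≋ negS φ → f ≋ compS k (negS φ)
  anticommuting⇒conjugate-negS f φ k f₀≈0 φ₀≈0 k∘φ≋id φ∘f≋-φ = ≋-sym
    (≋-trans (compS-congʳ k (≋-sym φ∘f≋-φ)) (≋-trans (≋-sym (compS-assoc k φ f φ₀≈0 f₀≈0))
      (≋-trans (compS-congˡ f k∘φ≋id) (compS-idˡ f f₀≈0))))

  HasLahCoefficients : Series → Set (c ⊔ ℓ)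
  HasLahCoefficients f = Σ (ℕ → Carrier) (λ g → ¬ (g 1 ≈ 0#) × (∀ n → taylor f (suc n) ≈ L (suc n) 1 g))

  listSum : List Carrier → Carrier
  listSum = foldr _+_ 0#

  listSum-++ : ∀ xs ys → listSum (xs ++ ys) ≈ listSum xs + listSum ys
  listSum-++ []       ys = sym (+-identityˡ _)
  listSum-++ (x ∷ xs) ys = trans (+-congˡ (listSum-++ xs ys)) (sym (+-assoc _ _ _))

  listSum-map-cong : ∀ {A : Set} {φ ψ : A → Carrier} (xs : List A) →
    (∀ x → φ x ≈ ψ x) → listSum (map φ xs) ≈ listSum (map ψ xs)
  listSum-map-cong []       φ≈ψ = refl
  listSum-map-cong (x ∷ xs) φ≈ψ = +-cong (φ≈ψ x) (listSum-map-cong xs φ≈ψ)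

  listSum-map-*ˡ : ∀ {A : Set} (φ : A → Carrier) a (xs : List A) →
    listSum (map (λ x → a * φ x) xs) ≈ a * listSum (map φ xs)
  listSum-map-*ˡ φ a []       = sym (zeroʳ a)
  listSum-map-*ˡ φ a (x ∷ xs) = trans (+-congˡ (listSum-map-*ˡ φ a xs)) (sym (distribˡ _ _ _))

  listSum-map-onlyIf : ∀ {A : Set} (φ : A → Carrier) b (xs : List A) →
    listSum (map (λ x → onlyIf b (φ x)) xs) ≈ onlyIf b (listSum (map φ xs))
  listSum-map-onlyIf φ true  xs       = refl
  listSum-map-onlyIf φ false []       = refl
  listSum-map-onlyIf φ false (x ∷ xs) = trans (+-identityˡ _) (listSum-map-onlyIf φ false xs)

  listSum-concatMap : ∀ {A B : Set} (φ : B → Carrier) (ψ : A → List B) (xs : List A) →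
    listSum (map φ (concatMap ψ xs)) ≈ listSum (map (λ x → listSum (map φ (ψ x))) xs)
  listSum-concatMap φ ψ []       = refl
  listSum-concatMap φ ψ (x ∷ xs) = begin
    listSum (map φ (ψ x ++ concatMap ψ xs))                ≡⟨ ≡.cong listSum (map-++ φ (ψ x) (concatMap ψ xs)) ⟩
    listSum (map φ (ψ x) ++ map φ (concatMap ψ xs))        ≈⟨ listSum-++ (map φ (ψ x)) _ ⟩
    listSum (map φ (ψ x)) + listSum (map φ (concatMap ψ xs)) ≈⟨ +-congˡ (listSum-concatMap φ ψ xs) ⟩
    listSum (map φ (ψ x)) + listSum (map (λ x → listSum (map φ (ψ x))) xs) ∎

  listSum-range : ∀ (φ : ℕ → Carrier) m → listSum (map φ (range m)) ≈ sumFrom 0 (suc m) φ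
  listSum-range φ zero    = refl
  listSum-range φ (suc m) = begin
    listSum (map φ (range m ++ (suc m ∷ [])))         ≡⟨ ≡.cong listSum (map-++ φ (range m) (suc m ∷ [])) ⟩
    listSum (map φ (range m) ++ (φ (suc m) ∷ []))     ≈⟨ listSum-++ (map φ (range m)) _ ⟩
    listSum (map φ (range m)) + (φ (suc m) + 0#)      ≈⟨ +-cong (listSum-range φ m) (+-identityʳ _) ⟩
    sumFrom 0 (suc m) φ + φ (suc m)                   ≈⟨ sumFrom-snoc 0 (suc m) φ ⟨
    sumFrom 0 (suc (suc m)) φ                         ∎

  module CharacteristicZero (charZero : CharZero) where

    fromℕ-nonzero : ∀ n → .{{NonZero n}} → ¬ (fromℕ n ≈ 0#)
    fromℕ-nonzero (suc n) = charZero n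

    fromℕ-!-nonzero : ∀ n → ¬ (fromℕ (n !) ≈ 0#)
    fromℕ-!-nonzero n = fromℕ-nonzero (n !) {{n !≢0}}

    nCk*k!*[n∸k]!≡n! : ∀ n k → k ≤ n → (n C k) ℕ* (k ! ℕ* (n ∸ k) !) ≡ n !
    nCk*k!*[n∸k]!≡n! n k k≤n =
      ≡.trans (≡.cong (_ℕ* (k ! ℕ* (n ∸ k) !)) (nCk≡n!/k![n-k]! k≤n))
              (m/n*n≡m {{k !* (n ∸ k) !≢0}} (k![n∸k]!∣n! k≤n))

    -- Σ_{j ≥ 1} X j x^j / j!, the series with Taylor coefficients X 1, X 2, …
    egf : (ℕ → Carrier) → Series
    egf X zero    = 0#
    egf X (suc i) = X (suc i) * fromℕ (suc i !) ⁻¹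

    egf-linear≉0 : ∀ X → ¬ (X 1 ≈ 0#) → ¬ (egf X 1 ≈ 0#)
    egf-linear≉0 X X₁≉0 = *-nonzero X₁≉0 (⁻¹-nonzero (fromℕ-!-nonzero 1))

    egf-taylor : ∀ f → f 0 ≈ 0# → egf (taylor f) ≋ f
    egf-taylor f f₀≈0 zero    = sym f₀≈0
    egf-taylor f f₀≈0 (suc i) = trans (*-comm _ _) (x*b≈t⇒b⁻¹*t≈x (fromℕ-!-nonzero (suc i)) (*-comm _ _))

    taylor-injective : ∀ {f g} → f 0 ≈ g 0 → (∀ n → taylor f (suc n) ≈ taylor g (suc n)) → f ≋ g
    taylor-injective f₀≈g₀ taylor≈ zero    = f₀≈g₀
    taylor-injective f₀≈g₀ taylor≈ (suc n) = *-cancelˡ (fromℕ-!-nonzero (suc n)) (taylor≈ n)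

    module BellPolynomial (X : ℕ → Carrier) where

      blockWeight : ℕ → ℕ → ℕ
      blockWeight j a = a ! ℕ* (j !) ℕ^ a

      blockWeight-nonzero : ∀ j a → NonZero (blockWeight j a)
      blockWeight-nonzero j a = ℕ.m*n≢0 (a !) ((j !) ℕ^ a) {{a !≢0}} {{ℕ.m^n≢0 (j !) a {{j !≢0}}}}

      blockCoeff : ℕ → ℕ → Carrier
      blockCoeff j a = X j ^ a * fromℕ (blockWeight j a) ⁻¹

      summary-den-nonzero : ∀ j {len} (ks : Vec ℕ len) → NonZero (Summary.den (summary X j ks))
      summary-den-nonzero j []       = _
      summary-den-nonzero j (a ∷ ks) with summary X (suc j) ks | summary-den-nonzero (suc j) ks
      ... | ⟨ _ , _ , _ , d ⟩ | d≢0 = ℕ.m*n≢0 (blockWeight j a) d {{blockWeight-nonzero j a}} {{d≢0}}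

      -- The contribution of a multiplicity vector to B, without the factor n!.
      summaryTerm : ℕ → ℕ → Summary → Carrier
      summaryTerm k n ⟨ k′ , n′ , m , d ⟩ = onlyIf ((k′ ≡ᵇ k) ∧ (n′ ≡ᵇ n)) (m * fromℕ d ⁻¹)

      vecTerm : ℕ → ℕ → ℕ → ∀ {len} → Vec ℕ len → Carrier
      vecTerm j k n ks = summaryTerm k n (summary X j ks)

      bellTerm≈ : ∀ n k (ks : Vec ℕ n) → bellTerm n k X ks ≈ fromℕ (n !) * vecTerm 1 k n ks
      bellTerm≈ n k ks with summary X 1 ks
      ... | ⟨ k′ , n′ , m , d ⟩ with (k′ ≡ᵇ k) ∧ (n′ ≡ᵇ n)
      ...   | true  = *-assoc _ _ _
      ...   | false = sym (zeroʳ _)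

      consSummary : ℕ → ℕ → Summary → Summary
      consSummary j a ⟨ k′ , n′ , m , d ⟩ = ⟨ a ℕ+ k′ , j ℕ* a ℕ+ n′ , X j ^ a * m , blockWeight j a ℕ* d ⟩

      summaryTerm-cons : ∀ j k n a s → NonZero (Summary.den s) →
        summaryTerm k n (consSummary j a s) ≈
        onlyIf ((a ≤ᵇ k) ∧ (j ℕ* a ≤ᵇ n)) (blockCoeff j a * summaryTerm (k ∸ a) (n ∸ j ℕ* a) s)
      summaryTerm-cons j k n a ⟨ k′ , n′ , m , d ⟩ d≢0
        rewrite +-≡ᵇ a k′ k | +-≡ᵇ (j ℕ* a) n′ n
              | ∧-interchange (a ≤ᵇ k) (k′ ≡ᵇ k ∸ a) (j ℕ* a ≤ᵇ n) (n′ ≡ᵇ n ∸ j ℕ* a)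
        with (a ≤ᵇ k) ∧ (j ℕ* a ≤ᵇ n) | (k′ ≡ᵇ k ∸ a) ∧ (n′ ≡ᵇ n ∸ j ℕ* a)
      ... | false | _     = refl
      ... | true  | false = sym (zeroʳ _)
      ... | true  | true  = begin
        (X j ^ a * m) * fromℕ (blockWeight j a ℕ* d) ⁻¹
          ≈⟨ *-congˡ (trans (⁻¹-cong (fromℕ-nonzero _ {{ℕ.m*n≢0 _ _ {{blockWeight-nonzero j a}} {{d≢0}}}})
                                     (fromℕ-* (blockWeight j a) d))
                            (⁻¹-distrib-* (fromℕ-nonzero _ {{blockWeight-nonzero j a}}) (fromℕ-nonzero d {{d≢0}}))) ⟩
        (X j ^ a * m) * (fromℕ (blockWeight j a) ⁻¹ * fromℕ d ⁻¹)
          ≈⟨ Solver.solve 4 (λ x y z t → (x :* y) :* (z :* t) := (x :* z) :* (y :* t)) refl (X j ^ a) m _ _ ⟩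
        blockCoeff j a * (m * fromℕ d ⁻¹) ∎

      vecTerm-∷ : ∀ j k n a {len} (ks : Vec ℕ len) → vecTerm j k n (a ∷ ks) ≈
        onlyIf ((a ≤ᵇ k) ∧ (j ℕ* a ≤ᵇ n)) (blockCoeff j a * vecTerm (suc j) (k ∸ a) (n ∸ j ℕ* a) ks)
      vecTerm-∷ j k n a ks =
        summaryTerm-cons j k n a (summary X (suc j) ks) (summary-den-nonzero (suc j) ks)

      vecSum : ℕ → ℕ → ℕ → ℕ → ℕ → Carrier
      vecSum M j len k n = listSum (map (vecTerm j k n) (vecs M len))

      vecSum-suc : ∀ M j len k n → vecSum M j (suc len) k n ≈
        sumFrom 0 (suc M) (λ a → onlyIf ((a ≤ᵇ k) ∧ (j ℕ* a ≤ᵇ n))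
                                        (blockCoeff j a * vecSum M (suc j) len (k ∸ a) (n ∸ j ℕ* a)))
      vecSum-suc M j len k n = begin
        listSum (map (vecTerm j k n) (concatMap (λ a → map (a ∷_) (vecs M len)) (range M)))
          ≈⟨ listSum-concatMap (vecTerm j k n) (λ a → map (a ∷_) (vecs M len)) (range M) ⟩
        listSum (map (λ a → listSum (map (vecTerm j k n) (map (a ∷_) (vecs M len)))) (range M))
          ≈⟨ listSum-range _ M ⟩
        sumFrom 0 (suc M) (λ a → listSum (map (vecTerm j k n) (map (a ∷_) (vecs M len))))
          ≈⟨ sumFrom-cong 0 (suc M) (λ a → begin
               listSum (map (vecTerm j k n) (map (a ∷_) (vecs M len)))
                 ≡⟨ ≡.cong listSum (≡.sym (map-∘ (vecs M len))) ⟩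
               listSum (map (vecTerm j k n ∘ (a ∷_)) (vecs M len))
                 ≈⟨ listSum-map-cong (vecs M len) (vecTerm-∷ j k n a) ⟩
               listSum (map (λ ks → onlyIf _ (blockCoeff j a * vecTerm (suc j) (k ∸ a) (n ∸ j ℕ* a) ks)) (vecs M len))
                 ≈⟨ listSum-map-onlyIf _ _ (vecs M len) ⟩
               onlyIf _ (listSum (map (λ ks → blockCoeff j a * vecTerm (suc j) (k ∸ a) (n ∸ j ℕ* a) ks) (vecs M len)))
                 ≈⟨ onlyIf-cong _ (listSum-map-*ˡ _ _ (vecs M len)) ⟩
               onlyIf _ (blockCoeff j a * vecSum M (suc j) len (k ∸ a) (n ∸ j ℕ* a)) ∎) ⟩
        sumFrom 0 (suc M) (λ a → onlyIf ((a ≤ᵇ k) ∧ (j ℕ* a ≤ᵇ n))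
                                        (blockCoeff j a * vecSum M (suc j) len (k ∸ a) (n ∸ j ℕ* a))) ∎

      -- The same sum, with the multiplicity of X j bounded by the remaining count k rather than by M.
      bellRec : ℕ → ℕ → ℕ → ℕ → Carrier
      bellRec j zero      k n = onlyIf ((0 ≡ᵇ k) ∧ (0 ≡ᵇ n)) 1#
      bellRec j (suc len) k n =
        sumFrom 0 (suc k) (λ a → onlyIf (j ℕ* a ≤ᵇ n) (blockCoeff j a * bellRec (suc j) len (k ∸ a) (n ∸ j ℕ* a)))

      vecSum≈bellRec : ∀ M j len k n → k ≤ M → vecSum M j len k n ≈ bellRec j len k n
      vecSum≈bellRec M j zero k n k≤M with (0 ≡ᵇ k) ∧ (0 ≡ᵇ n)
      ... | true  = trans (+-identityʳ _) (trans (*-identityˡ _) (trans (⁻¹-cong (fromℕ-nonzero 1) fromℕ1≈1) 1⁻¹≈1))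
      ... | false = +-identityʳ _
      vecSum≈bellRec M j (suc len) k n k≤M = begin
        vecSum M j (suc len) k n
          ≈⟨ vecSum-suc M j len k n ⟩
        sumFrom 0 (suc M) term
          ≡⟨ ≡.cong (λ m → sumFrom 0 (suc m) term) (ℕ.m+[n∸m]≡n k≤M) ⟨
        sumFrom 0 (suc k ℕ+ (M ∸ k)) term
          ≈⟨ sumFrom-extend 0 (suc k) (M ∸ k) term (λ a k<a → term-beyond a k<a) ⟩
        sumFrom 0 (suc k) term
          ≈⟨ sumFrom-cong-on 0 (suc k) (λ a _ a<1+k → term-within a (ℕ.≤-pred a<1+k)) ⟩
        bellRec j (suc len) k n ∎
        where
        term : ℕ → Carrier
        term a = onlyIf ((a ≤ᵇ k) ∧ (j ℕ* a ≤ᵇ n)) (blockCoeff j a * vecSum M (suc j) len (k ∸ a) (n ∸ j ℕ* a))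
        term-beyond : ∀ a → k < a → term a ≈ 0#
        term-beyond a k<a with a ≤ᵇ k | ℕ.≤ᵇ-reflects-≤ a k
        ... | false | _       = refl
        ... | true  | ofʸ a≤k = ⊥-elim (ℕ.<⇒≱ k<a a≤k)
        term-within : ∀ a → a ≤ k → term a ≈
          onlyIf (j ℕ* a ≤ᵇ n) (blockCoeff j a * bellRec (suc j) len (k ∸ a) (n ∸ j ℕ* a))
        term-within a a≤k with a ≤ᵇ k | ℕ.≤ᵇ-reflects-≤ a k
        ... | true  | _       = onlyIf-cong _ (*-congˡ (vecSum≈bellRec M (suc j) len (k ∸ a) (n ∸ j ℕ* a)
                                                   (ℕ.≤-trans (ℕ.m∸n≤m k a) k≤M)))
        ... | false | ofⁿ a≰k = ⊥-elim (a≰k a≤k)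

      monomial : ℕ → Carrier → Series
      monomial p s n = onlyIf (n ≡ᵇ p) s

      mulS-monomial : ∀ p s V n → mulS (monomial p s) V n ≈ onlyIf (p ≤ᵇ n) (s * V (n ∸ p))
      mulS-monomial p s V n with p ≤ᵇ n | ℕ.≤ᵇ-reflects-≤ p n
      ... | true  | ofʸ p≤n =
        trans (sumFrom-single 0 (suc n) p _ z≤n (s≤s p≤n) (λ i _ _ i≢p → term≈0 i i≢p))
              (*-congʳ (onlyIf-≡ᵇ-refl p s))
        where
        term≈0 : ∀ i → ¬ (i ≡ p) → monomial p s i * V (n ∸ i) ≈ 0#
        term≈0 i i≢p = trans (*-congʳ (onlyIf-≡ᵇ-≢ s i≢p)) (zeroˡ _)
      ... | false | ofⁿ p≰n = sumFrom-≈0 0 (suc n) term≈0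
        where
        term≈0 : ∀ i → 0 ≤ i → i < suc n → monomial p s i * V (n ∸ i) ≈ 0#
        term≈0 i _ (s≤s i≤n) = trans (*-congʳ (onlyIf-≡ᵇ-≢ {i} {p} s (λ { ≡.refl → p≰n i≤n }))) (zeroˡ _)

      powS-monomial : ∀ p s a → powS (monomial p s) a ≋ monomial (p ℕ* a) (s ^ a)
      powS-monomial p s zero    n = reflexive (≡.cong (λ m → onlyIf (n ≡ᵇ m) 1#) (≡.sym (ℕ.*-zeroʳ p)))
      powS-monomial p s (suc a) n
        with p ≤ᵇ n | ℕ.≤ᵇ-reflects-≤ p n | mulS-monomial p s (powS (monomial p s) a) n
      ... | true  | ofʸ p≤n | product≈ = begin
        mulS (monomial p s) (powS (monomial p s) a) n      ≈⟨ product≈ ⟩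
        s * powS (monomial p s) a (n ∸ p)                  ≈⟨ *-congˡ (powS-monomial p s a (n ∸ p)) ⟩
        s * onlyIf (n ∸ p ≡ᵇ p ℕ* a) (s ^ a)               ≈⟨ *-onlyIf _ s _ ⟩
        onlyIf (n ∸ p ≡ᵇ p ℕ* a) (s ^ suc a)               ≡⟨ ≡.cong (λ b → onlyIf b (s ^ suc a)) n∸p≡ᵇp*a ⟩
        onlyIf (n ≡ᵇ p ℕ* suc a) (s ^ suc a)               ∎
        where
        n∸p≡ᵇp*a : (n ∸ p ≡ᵇ p ℕ* a) ≡ (n ≡ᵇ p ℕ* suc a)
        n∸p≡ᵇp*a = ≡ᵇ-≡ {n ∸ p} {p ℕ* a} {n} {p ℕ* suc a}
          (λ n∸p≡p*a → ≡.trans (≡.sym (ℕ.m+[n∸m]≡n p≤n)) (≡.trans (≡.cong (p ℕ+_) n∸p≡p*a) (≡.sym (ℕ.*-suc p a))))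
          (λ n≡p*[1+a] → ≡.trans (≡.cong (_∸ p) (≡.trans n≡p*[1+a] (ℕ.*-suc p a))) (ℕ.m+n∸m≡n p (p ℕ* a)))
      ... | false | ofⁿ p≰n | product≈ = trans product≈ (sym (onlyIf-≡ᵇ-≢ _ n≢p*[1+a]))
        where
        n≢p*[1+a] : ¬ (n ≡ p ℕ* suc a)
        n≢p*[1+a] n≡p*[1+a] = p≰n (≡.subst (p ≤_) (≡.sym (≡.trans n≡p*[1+a] (ℕ.*-suc p a))) (ℕ.m≤m+n p _))

      scaled : ℕ → Carrier
      scaled j = X j * fromℕ (j !) ⁻¹

      window : ℕ → ℕ → Series
      window j zero      = zeroS
      window j (suc len) = addS (monomial j (scaled j)) (window (suc j) len)

      binomial-blockCoeff : ∀ j a k q → a ≤ k →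
        fromℕ (k C a) * (scaled j ^ a * (fromℕ ((k ∸ a) !) * q)) ≈ fromℕ (k !) * (blockCoeff j a * q)
      binomial-blockCoeff j a k q a≤k = sym (begin
        fromℕ (k !) * (blockCoeff j a * q)
          ≈⟨ *-cong k!≈ (*-congʳ blockCoeff≈) ⟩
        (kCa * (a! * r!)) * ((X j ^ a * (a! ⁻¹ * (j! ⁻¹) ^ a)) * q)
          ≈⟨ Solver.solve 7 (λ cc a′ r′ xa ia ji qv →
               (cc :* (a′ :* r′)) :* ((xa :* (ia :* ji)) :* qv) := (cc :* ((xa :* ji) :* (r′ :* qv))) :* (a′ :* ia))
               refl kCa a! r! (X j ^ a) (a! ⁻¹) ((j! ⁻¹) ^ a) q ⟩
        (kCa * ((X j ^ a * (j! ⁻¹) ^ a) * (r! * q))) * (a! * a! ⁻¹)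
          ≈⟨ *-congˡ (⁻¹-inverse a! (fromℕ-!-nonzero a)) ⟩
        (kCa * ((X j ^ a * (j! ⁻¹) ^ a) * (r! * q))) * 1#
          ≈⟨ *-identityʳ _ ⟩
        kCa * ((X j ^ a * (j! ⁻¹) ^ a) * (r! * q))
          ≈⟨ *-congˡ (*-congʳ (sym (^-distrib-* (X j) (j! ⁻¹) a))) ⟩
        kCa * (scaled j ^ a * (r! * q)) ∎)
        where
        kCa a! r! j! : Carrier
        kCa = fromℕ (k C a)
        a!  = fromℕ (a !)
        r!  = fromℕ ((k ∸ a) !)
        j!  = fromℕ (j !)
        k!≈ : fromℕ (k !) ≈ kCa * (a! * r!)
        k!≈ = trans (reflexive (≡.cong fromℕ (≡.sym (nCk*k!*[n∸k]!≡n! k a a≤k))))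
                    (trans (fromℕ-* (k C a) _) (*-congˡ (fromℕ-* (a !) ((k ∸ a) !))))
        blockCoeff≈ : blockCoeff j a ≈ X j ^ a * (a! ⁻¹ * (j! ⁻¹) ^ a)
        blockCoeff≈ = *-congˡ (trans (⁻¹-cong (fromℕ-nonzero _ {{blockWeight-nonzero j a}})
                                               (trans (fromℕ-* (a !) _) (*-congˡ (fromℕ-^ (j !) a))))
                        (trans (⁻¹-distrib-* (fromℕ-!-nonzero a) (^-nonzero a (fromℕ-!-nonzero j)))
                               (*-congˡ (⁻¹-^ a (fromℕ-!-nonzero j)))))

      powS-window : ∀ j len k n → powS (window j len) k n ≈ fromℕ (k !) * bellRec j len k n
      powS-window j zero zero    zero    = sym (trans (*-identityʳ _) (+-identityʳ _))
      powS-window j zero zero    (suc n) = sym (zeroʳ _)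
      powS-window j zero (suc k) n       = trans (mulS-zeroˡ (powS zeroS k) n) (sym (zeroʳ _))
      powS-window j (suc len) k n = begin
        powS (addS (monomial j (scaled j)) (window (suc j) len)) k n
          ≈⟨ powS-binomial (monomial j (scaled j)) (window (suc j) len) k n ⟩
        sumFrom 0 (suc k) (λ a → fromℕ (k C a) *
          mulS (powS (monomial j (scaled j)) a) (powS (window (suc j) len) (k ∸ a)) n)
          ≈⟨ sumFrom-cong-on 0 (suc k) (λ a _ a<1+k → binomialTerm≈ a (ℕ.≤-pred a<1+k)) ⟩
        sumFrom 0 (suc k) (λ a → fromℕ (k !) * onlyIf (j ℕ* a ≤ᵇ n) (blockCoeff j a * rest a))
          ≈⟨ sumFrom-*ˡ 0 (suc k) (fromℕ (k !)) _ ⟩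
        fromℕ (k !) * bellRec j (suc len) k n ∎
        where
        rest : ℕ → Carrier
        rest a = bellRec (suc j) len (k ∸ a) (n ∸ j ℕ* a)
        binomialTerm≈ : ∀ a → a ≤ k →
          fromℕ (k C a) * mulS (powS (monomial j (scaled j)) a) (powS (window (suc j) len) (k ∸ a)) n ≈
          fromℕ (k !) * onlyIf (j ℕ* a ≤ᵇ n) (blockCoeff j a * rest a)
        binomialTerm≈ a a≤k = begin
          fromℕ (k C a) * mulS (powS (monomial j (scaled j)) a) (powS (window (suc j) len) (k ∸ a)) n
            ≈⟨ *-congˡ (mulS-cong {g = powS (window (suc j) len) (k ∸ a)} (powS-monomial j (scaled j) a) ≋-refl n) ⟩
          fromℕ (k C a) * mulS (monomial (j ℕ* a) (scaled j ^ a)) (powS (window (suc j) len) (k ∸ a)) n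
            ≈⟨ *-congˡ (mulS-monomial (j ℕ* a) _ (powS (window (suc j) len) (k ∸ a)) n) ⟩
          fromℕ (k C a) * onlyIf (j ℕ* a ≤ᵇ n) (scaled j ^ a * powS (window (suc j) len) (k ∸ a) (n ∸ j ℕ* a))
            ≈⟨ *-congˡ (onlyIf-cong _ (*-congˡ (powS-window (suc j) len (k ∸ a) (n ∸ j ℕ* a)))) ⟩
          fromℕ (k C a) * onlyIf (j ℕ* a ≤ᵇ n) (scaled j ^ a * (fromℕ ((k ∸ a) !) * rest a))
            ≈⟨ *-onlyIf _ _ _ ⟩
          onlyIf (j ℕ* a ≤ᵇ n) (fromℕ (k C a) * (scaled j ^ a * (fromℕ ((k ∸ a) !) * rest a)))
            ≈⟨ onlyIf-cong _ (binomial-blockCoeff j a k (rest a) a≤k) ⟩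
          onlyIf (j ℕ* a ≤ᵇ n) (fromℕ (k !) * (blockCoeff j a * rest a))
            ≈⟨ *-onlyIf _ _ _ ⟨
          fromℕ (k !) * onlyIf (j ℕ* a ≤ᵇ n) (blockCoeff j a * rest a) ∎

      window-below : ∀ j len i → i < j → window j len i ≈ 0#
      window-below j zero      i i<j = refl
      window-below j (suc len) i i<j =
        trans (+-cong (onlyIf-≡ᵇ-≢ _ (ℕ.<⇒≢ i<j)) (window-below (suc j) len i (ℕ.m<n⇒m<1+n i<j))) (+-identityˡ 0#)

      window-inside : ∀ j len i → j ≤ i → i < j ℕ+ len → window j len i ≈ scaled i
      window-inside j zero i j≤i i<j+0 = ⊥-elim (ℕ.<⇒≱ (≡.subst (i <_) (ℕ.+-identityʳ j) i<j+0) j≤i)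
      window-inside j (suc len) i j≤i i<j+1+len with j ℕ.≟ i
      ... | yes ≡.refl =
        trans (+-cong (onlyIf-≡ᵇ-refl j _) (window-below (suc j) len j (ℕ.n<1+n j))) (+-identityʳ _)
      ... | no  j≢i    =
        trans (+-cong (onlyIf-≡ᵇ-≢ _ (j≢i ∘ ≡.sym))
                      (window-inside (suc j) len i (ℕ.≤∧≢⇒< j≤i j≢i) (≡.subst (i <_) (ℕ.+-suc j len) i<j+1+len)))
              (+-identityˡ _)

      window-agrees-egf : ∀ n → AgreeUpTo n (window 1 n) (egf X)
      window-agrees-egf n zero    _   = window-below 1 n 0 (s≤s z≤n)
      window-agrees-egf n (suc i) i<n = window-inside 1 n (suc i) (s≤s z≤n) (s≤s i<n)

      B≈powS-egf : ∀ n k → k ≤ n → B n k X ≈ fromℕ (n !) * fromℕ (k !) ⁻¹ * powS (egf X) k n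
      B≈powS-egf n k k≤n = begin
        listSum (map (bellTerm n k X) (vecs n n))
          ≈⟨ listSum-map-cong (vecs n n) (bellTerm≈ n k) ⟩
        listSum (map (λ ks → fromℕ (n !) * vecTerm 1 k n ks) (vecs n n))
          ≈⟨ listSum-map-*ˡ (vecTerm 1 k n) _ (vecs n n) ⟩
        fromℕ (n !) * vecSum n 1 n k n
          ≈⟨ *-congˡ (vecSum≈bellRec n 1 n k n k≤n) ⟩
        fromℕ (n !) * bellRec 1 n k n
          ≈⟨ *-congˡ (x*b≈t⇒b⁻¹*t≈x (fromℕ-!-nonzero k) (trans (*-comm _ _) (sym (powS-window 1 n k n)))) ⟨
        fromℕ (n !) * (fromℕ (k !) ⁻¹ * powS (window 1 n) k n)
          ≈⟨ *-congˡ (*-congˡ (powS-agree n k (window-agrees-egf n) n ℕ.≤-refl)) ⟩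
        fromℕ (n !) * (fromℕ (k !) ⁻¹ * powS (egf X) k n)
          ≈⟨ *-assoc _ _ _ ⟨
        fromℕ (n !) * fromℕ (k !) ⁻¹ * powS (egf X) k n ∎

    module InverseCoefficients (X : ℕ → Carrier) (X₁≉0 : ¬ (X 1 ≈ 0#))
                               (h : Series) (h-inverse : RightInverseOf (egf X) h) where
      open BellPolynomial X using (B≈powS-egf)

      h₀≈0 : h 0 ≈ 0#
      h₀≈0 = proj₁ h-inverse

      egf∘h≋id : compS (egf X) h ≋ idS
      egf∘h≋id = proj₂ (proj₂ h-inverse)

      inverseCoeff : ℕ → ℕ → Carrier
      inverseCoeff n j = fromℕ (n !) * fromℕ (j !) ⁻¹ * powS h j n

      -- (g ∘ h)^k = x^k, expanded as Σ_j [x^j] g^k · h^j.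
      powS-egf∘h : ∀ n k → sumFrom 0 (suc n) (λ j → powS (egf X) k j * powS h j n) ≈ δ n k
      powS-egf∘h n k =
        trans (compS-powS (egf X) h h₀≈0 k n) (trans (powS-cong k egf∘h≋id n) (powS-idS k n))

      factorialRatio-δ : ∀ n k → fromℕ (n !) * fromℕ (k !) ⁻¹ * δ n k ≈ δ n k
      factorialRatio-δ n k with n ℕ.≟ k
      ... | yes ≡.refl = trans (*-congˡ (onlyIf-≡ᵇ-refl n 1#)) (trans (*-identityʳ _)
                           (trans (⁻¹-inverse _ (fromℕ-!-nonzero n)) (sym (onlyIf-≡ᵇ-refl n 1#))))
      ... | no  n≢k    = trans (*-congˡ (onlyIf-≡ᵇ-≢ 1# n≢k)) (trans (zeroʳ _) (sym (onlyIf-≡ᵇ-≢ 1# n≢k)))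

      inverseCoeff-solves : ∀ n k → k ≤ n →
        sumFrom k (suc n ∸ k) (λ j → inverseCoeff n j * B j k X) ≈ δ n k
      inverseCoeff-solves n k k≤n = begin
        sumFrom k (suc n ∸ k) (λ j → inverseCoeff n j * B j k X)
          ≈⟨ sumFrom-cong-on k (suc n ∸ k) (λ j k≤j _ → term≈ j k≤j) ⟩
        sumFrom k (suc n ∸ k) (λ j → ratio * summand j)
          ≈⟨ sumFrom-*ˡ k (suc n ∸ k) ratio summand ⟩
        ratio * sumFrom k (suc n ∸ k) summand
          ≈⟨ *-congˡ (sumFrom-skip k (suc n ∸ k) summand (λ j j<k →
               trans (*-congʳ (powS-vanishes-below (egf X) refl k j j<k)) (zeroˡ _))) ⟨
        ratio * sumFrom 0 (k ℕ+ (suc n ∸ k)) summand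
          ≡⟨ ≡.cong (λ m → ratio * sumFrom 0 m summand) (ℕ.m+[n∸m]≡n (ℕ.m≤n⇒m≤1+n k≤n)) ⟩
        ratio * sumFrom 0 (suc n) summand
          ≈⟨ *-congˡ (powS-egf∘h n k) ⟩
        ratio * δ n k
          ≈⟨ factorialRatio-δ n k ⟩
        δ n k ∎
        where
        ratio : Carrier
        ratio = fromℕ (n !) * fromℕ (k !) ⁻¹
        summand : ℕ → Carrier
        summand j = powS (egf X) k j * powS h j n
        term≈ : ∀ j → k ≤ j → inverseCoeff n j * B j k X ≈ ratio * summand j
        term≈ j k≤j = begin
          inverseCoeff n j * B j k X
            ≈⟨ *-congˡ (B≈powS-egf j k k≤j) ⟩
          (fromℕ (n !) * fromℕ (j !) ⁻¹ * powS h j n) * (fromℕ (j !) * fromℕ (k !) ⁻¹ * powS (egf X) k j)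
            ≈⟨ Solver.solve 6 (λ nf ij hj jf ik gk →
                 (nf :* ij :* hj) :* (jf :* ik :* gk) := (nf :* ik :* (gk :* hj)) :* (ij :* jf)) refl
                 (fromℕ (n !)) (fromℕ (j !) ⁻¹) (powS h j n) (fromℕ (j !)) (fromℕ (k !) ⁻¹) (powS (egf X) k j) ⟩
          (ratio * (powS (egf X) k j * powS h j n)) * (fromℕ (j !) ⁻¹ * fromℕ (j !))
            ≈⟨ *-congˡ (x⁻¹*x≈1 (fromℕ-!-nonzero j)) ⟩
          (ratio * (powS (egf X) k j * powS h j n)) * 1#
            ≈⟨ *-identityʳ _ ⟩
          ratio * (powS (egf X) k j * powS h j n) ∎

      B-diagonal-nonzero : ∀ k → ¬ (B k k X ≈ 0#)
      B-diagonal-nonzero k Bkk≈0 = ^-nonzero k (egf-linear≉0 X X₁≉0) (begin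
        egf X 1 ^ k                                             ≈⟨ powS-diagonal (egf X) refl k ⟨
        powS (egf X) k k                                        ≈⟨ *-identityˡ _ ⟨
        1# * powS (egf X) k k                                   ≈⟨ *-congʳ (⁻¹-inverse _ (fromℕ-!-nonzero k)) ⟨
        fromℕ (k !) * fromℕ (k !) ⁻¹ * powS (egf X) k k         ≈⟨ B≈powS-egf k k ℕ.≤-refl ⟨
        B k k X                                                 ≈⟨ Bkk≈0 ⟩
        0#                                                      ∎)

      rowSum : ℕ → List (ℕ × Carrier) → Carrier
      rowSum k = foldr (λ p acc → proj₂ p * B (proj₁ p) k X + acc) 0#

      foldr≈rowSum : ∀ k (φ : ℕ × Carrier → Carrier → Carrier) →
        (∀ p acc → φ p acc ≈ proj₂ p * B (proj₁ p) k X + acc) → ∀ ps → foldr φ 0# ps ≈ rowSum k ps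
      foldr≈rowSum k φ φ≈ []       = refl
      foldr≈rowSum k φ φ≈ (p ∷ ps) = trans (φ≈ p _) (+-congˡ (foldr≈rowSum k φ φ≈ ps))

      -- row n X d lists the pairs (j , A n j X) for n ∸ d ≤ j ≤ n: the triangular system is solved
      -- from the bottom.
      row-correct : ∀ n d → d < n →
        (headVal (row n X d) ≈ inverseCoeff n (n ∸ d)) ×
        (∀ k → rowSum k (row n X d) ≈ sumFrom (n ∸ d) (suc d) (λ j → inverseCoeff n j * B j k X))
      row-correct n zero 0<n = head , λ k → +-congʳ (*-congʳ head)
        where
        head : B n n X ⁻¹ * δ n n ≈ inverseCoeff n n
        head = x*b≈t⇒b⁻¹*t≈x (B-diagonal-nonzero n) (begin
          inverseCoeff n n * B n n X        ≈⟨ +-identityʳ _ ⟨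
          sumFrom n 1 term                  ≡⟨ ≡.cong (λ m → sumFrom n m term) (ℕ.m+n∸n≡m 1 n) ⟨
          sumFrom n (suc n ∸ n) term        ≈⟨ inverseCoeff-solves n n ℕ.≤-refl ⟩
          δ n n                             ∎)
          where
          term : ℕ → Carrier
          term j = inverseCoeff n j * B j n X
      row-correct n (suc d) 1+d<n = head , λ k → +-cong (*-congʳ head) (previous k)
        where
        k₀ : ℕ
        k₀ = n ∸ suc d
        term : ℕ → ℕ → Carrier
        term k j = inverseCoeff n j * B j k X
        previous : ∀ k → rowSum k (row n X d) ≈ sumFrom (suc k₀) (suc d) (term k)
        previous k = trans (proj₂ (row-correct n d (ℕ.<-trans (ℕ.n<1+n d) 1+d<n)) k)
          (reflexive (≡.cong (λ m → sumFrom m (suc d) (term k)) (ℕ.+-∸-assoc 1 (ℕ.<⇒≤ 1+d<n))))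
        1+n∸k₀≡2+d : suc n ∸ k₀ ≡ suc (suc d)
        1+n∸k₀≡2+d = ≡.trans (ℕ.+-∸-assoc 1 (ℕ.m∸n≤m n (suc d))) (≡.cong suc (ℕ.m∸[m∸n]≡n (ℕ.<⇒≤ 1+d<n)))
        equation : term k₀ k₀ + sumFrom (suc k₀) (suc d) (term k₀) ≈ δ n k₀
        equation = trans (reflexive (≡.cong (λ m → sumFrom k₀ m (term k₀)) (≡.sym 1+n∸k₀≡2+d)))
                         (inverseCoeff-solves n k₀ (ℕ.m∸n≤m n (suc d)))
        head : B k₀ k₀ X ⁻¹ * (δ n k₀ - foldr (λ { (j , a) acc → a * B j k₀ X + acc }) 0# (row n X d)) ≈
               inverseCoeff n k₀
        head = x*b≈t⇒b⁻¹*t≈x (B-diagonal-nonzero k₀) (trans (a+b≈c⇒a≈c-b equation)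
          (+-congˡ (-‿cong (sym (trans (foldr≈rowSum k₀ _ (λ p acc → refl) (row n X d)) (previous k₀))))))

      A≈inverseCoeff : ∀ n k → 1 ≤ k → k ≤ n → A n k X ≈ inverseCoeff n k
      A≈inverseCoeff n k 1≤k k≤n =
        trans (proj₁ (row-correct n (n ∸ k) (ℕ.∸-monoʳ-< {n} {k} {0} 1≤k k≤n)))
              (reflexive (≡.cong (inverseCoeff n) (ℕ.m∸[m∸n]≡n k≤n)))

      L≈taylor-compS-neg : ∀ n → L (suc n) 1 X ≈ taylor (compS (egf X) (negS h)) (suc n)
      L≈taylor-compS-neg n = begin
        sumFrom 1 N (λ j → (- 1#) ^ j * A N j X * B j 1 X)
          ≈⟨ sumFrom-cong-on 1 N (λ j 1≤j j<1+N → term≈ j 1≤j (ℕ.≤-pred j<1+N)) ⟩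
        sumFrom 1 N (λ j → N! * (egf X j * powS (negS h) j N))
          ≈⟨ sumFrom-*ˡ 1 N N! _ ⟩
        N! * sumFrom 1 N (λ j → egf X j * powS (negS h) j N)
          ≈⟨ *-congˡ (trans (+-congʳ (zeroˡ _)) (+-identityˡ _)) ⟨
        N! * compS (egf X) (negS h) N ∎
        where
        N : ℕ
        N = suc n
        N! : Carrier
        N! = fromℕ (N !)
        term≈ : ∀ j → 1 ≤ j → j ≤ N → (- 1#) ^ j * A N j X * B j 1 X ≈ N! * (egf X j * powS (negS h) j N)
        term≈ j 1≤j j≤N = begin
          (- 1#) ^ j * A N j X * B j 1 X
            ≈⟨ *-cong (*-congˡ (A≈inverseCoeff N j 1≤j j≤N)) (B≈powS-egf j 1 1≤j) ⟩
          (- 1#) ^ j * (N! * fromℕ (j !) ⁻¹ * powS h j N) * (fromℕ (j !) * fromℕ 1 ⁻¹ * powS (egf X) 1 j)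
            ≈⟨ Solver.solve 7 (λ m₁ a ij hj jf i₁ g →
                 m₁ :* (a :* ij :* hj) :* (jf :* i₁ :* g) := (a :* (g :* (m₁ :* hj))) :* ((ij :* jf) :* i₁)) refl
                 ((- 1#) ^ j) N! (fromℕ (j !) ⁻¹) (powS h j N) (fromℕ (j !)) (fromℕ 1 ⁻¹) (powS (egf X) 1 j) ⟩
          (N! * (powS (egf X) 1 j * ((- 1#) ^ j * powS h j N))) * ((fromℕ (j !) ⁻¹ * fromℕ (j !)) * fromℕ 1 ⁻¹)
            ≈⟨ *-cong (*-congˡ (*-cong (mulS-identityʳ (egf X) j) (sym (powS-negS h j N))))
                      (trans (*-cong (x⁻¹*x≈1 (fromℕ-!-nonzero j)) (trans (⁻¹-cong (fromℕ-nonzero 1) fromℕ1≈1) 1⁻¹≈1))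
                             (*-identityˡ 1#)) ⟩
          (N! * (egf X j * powS (negS h) j N)) * 1#
            ≈⟨ *-identityʳ _ ⟩
          N! * (egf X j * powS (negS h) j N) ∎

    x≈-x⇒x≈0 : ∀ x → x ≈ - x → x ≈ 0#
    x≈-x⇒x≈0 x x≈-x = *-cancelˡ (charZero 1) (begin
      fromℕ 2 * x            ≈⟨ distribʳ _ _ _ ⟩
      1# * x + fromℕ 1 * x   ≈⟨ +-cong (*-identityˡ x) (trans (*-congʳ fromℕ1≈1) (*-identityˡ x)) ⟩
      x + x                  ≈⟨ +-congˡ x≈-x ⟩
      x - x                  ≈⟨ -‿inverseʳ x ⟩
      0#                     ≈⟨ zeroʳ _ ⟨
      fromℕ 2 * 0#           ∎)

    module Involution (f : Series) (f₀≈0 : f 0 ≈ 0#) (f∘f≋id : compS f f ≋ idS) where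

      half : Carrier
      half = fromℕ 2 ⁻¹

      half≉0 : ¬ (half ≈ 0#)
      half≉0 = ⁻¹-nonzero (charZero 1)

      conjugator : Series
      conjugator n = half * (idS n - f n)

      conjugator₀≈0 : conjugator 0 ≈ 0#
      conjugator₀≈0 = trans (*-congˡ (trans (+-identityˡ _) (trans (-‿cong f₀≈0) -0#≈0#))) (zeroʳ _)

      conjugator∘f≋-conjugator : compS conjugator f ≋ negS conjugator
      conjugator∘f≋-conjugator n = begin
        compS conjugator f n
          ≈⟨ compS-scaleˡ half (addS idS (negS f)) f n ⟩
        half * compS (addS idS (negS f)) f n
          ≈⟨ *-congˡ (trans (compS-addˡ idS (negS f) f n) (+-cong (compS-idˡ f f₀≈0 n) (compS-negˡ f f n))) ⟩
        half * (f n - compS f f n)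
          ≈⟨ *-congˡ (+-congˡ (-‿cong (f∘f≋id n))) ⟩
        half * (f n - idS n)
          ≈⟨ *-congˡ (trans (+-congʳ (sym (-‿involutive (f n)))) (-‿+-comm (- f n) (idS n))) ⟩
        half * - (- f n + idS n)
          ≈⟨ *-congˡ (-‿cong (+-comm _ _)) ⟩
        half * - (idS n - f n)
          ≈⟨ -‿distribʳ-* _ _ ⟨
        - conjugator n ∎

      conjugator≈0⇒f≈id : ∀ n → conjugator n ≈ 0# → f n ≈ idS n
      conjugator≈0⇒f≈id n conjugatorₙ≈0 = sym (x∙y⁻¹≈ε⇒x≈y (idS n) (f n)
        (*-cancelˡ half≉0 (trans conjugatorₙ≈0 (sym (zeroʳ _)))))

      -- If f₁ = 1, comparing coefficients of degree m in φ ∘ f = -φ (φ the conjugator) gives φₘ = -φₘ,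
      -- as long as the lower coefficients of φ vanish; so φ = 0 and f = id.
      conjugator-linear≉0 : ¬ (f ≋ idS) → ¬ (conjugator 1 ≈ 0#)
      conjugator-linear≉0 f≉id conjugator₁≈0 = f≉id (λ n → conjugator≈0⇒f≈id n (vanishes n n ℕ.≤-refl))
        where
        f₁≈1 : f 1 ≈ 1#
        f₁≈1 = conjugator≈0⇒f≈id 1 conjugator₁≈0
        vanishes : ∀ n → AgreeUpTo n conjugator zeroS
        vanishes zero    zero _ = conjugator₀≈0
        vanishes (suc n) i i≤1+n with i ℕ.≤? n
        ... | yes i≤n = vanishes n i i≤n
        ... | no  i≰n rewrite ℕ.≤-antisym i≤1+n (ℕ.≰⇒> i≰n) = x≈-x⇒x≈0 (conjugator m) (begin
          conjugator m                      ≈⟨ *-identityʳ _ ⟨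
          conjugator m * 1#                 ≈⟨ *-congˡ f^m≈1 ⟨
          conjugator m * powS f m m         ≈⟨ sumFrom-single 0 (suc m) m _ z≤n ℕ.≤-refl (λ k _ k<1+m k≢m →
                                                 trans (*-congʳ (vanishes n k (lower k<1+m k≢m))) (zeroˡ _)) ⟨
          compS conjugator f m              ≈⟨ conjugator∘f≋-conjugator m ⟩
          - conjugator m                    ∎)
          where
          m : ℕ
          m = suc n
          f^m≈1 : powS f m m ≈ 1#
          f^m≈1 = trans (powS-diagonal f f₀≈0 m) (trans (^-congˡ m f₁≈1) (1^n≈1 m))
          lower : ∀ {k} → k < suc m → ¬ (k ≡ m) → k ≤ n
          lower k<1+m k≢m = ℕ.≤-pred (ℕ.≤∧≢⇒< (ℕ.≤-pred k<1+m) k≢m)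

    involutory⇒NegationConjugate : ∀ {f} → f 0 ≈ 0# → ¬ (f ≋ idS) → compS f f ≋ idS → NegationConjugate f
    involutory⇒NegationConjugate {f} f₀≈0 f≉id f∘f≋id =
      conjugate (rightInverse conjugator conjugator₀≈0 (conjugator-linear≉0 f≉id))
      where
      open Involution f f₀≈0 f∘f≋id
      conjugate : Σ Series (RightInverseOf conjugator) → NegationConjugate f
      conjugate (k , k₀≈0 , k₁≉0 , conjugator∘k≋id) = record
        { g = k ; h = conjugator ; g₀≈0 = k₀≈0 ; g₁≉0 = k₁≉0
        ; h-inverse = conjugator₀≈0 , conjugator-linear≉0 f≉id , k∘conjugator≋id
        ; f≋g∘-h = anticommuting⇒conjugate-negS f conjugator k f₀≈0 conjugator₀≈0
                     k∘conjugator≋id conjugator∘f≋-conjugator }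
        where
        k∘conjugator≋id : compS k conjugator ≋ idS
        k∘conjugator≋id = rightInverse⇒leftInverse conjugator k conjugator₀≈0 (k₀≈0 , k₁≉0 , conjugator∘k≋id)

    NegationConjugate⇒HasLahCoefficients : ∀ {f} → NegationConjugate f → HasLahCoefficients f
    NegationConjugate⇒HasLahCoefficients record { g = g ; h = h ; g₀≈0 = g₀≈0 ; g₁≉0 = g₁≉0
                                                    ; h-inverse = h₀≈0 , h₁≉0 , g∘h≋id ; f≋g∘-h = f≋g∘-h } =
      taylor g , taylor₁≉0 , λ n →
        trans (*-congˡ (trans (f≋g∘-h (suc n)) (compS-congˡ (negS h) (≋-sym (egf-taylor g g₀≈0)) (suc n))))
              (sym (L≈taylor-compS-neg n))
      where
      taylor₁≉0 : ¬ (taylor g 1 ≈ 0#)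
      taylor₁≉0 = *-nonzero (fromℕ-!-nonzero 1) g₁≉0
      open InverseCoefficients (taylor g) taylor₁≉0 h
        (h₀≈0 , h₁≉0 , ≋-trans (compS-congˡ h (egf-taylor g g₀≈0)) g∘h≋id)

    HasLahCoefficients⇒NegationConjugate : ∀ {f} → f 0 ≈ 0# → HasLahCoefficients f → NegationConjugate f
    HasLahCoefficients⇒NegationConjugate {f} f₀≈0 (g , g₁≉0 , taylor-f≈L) =
      conjugate (rightInverse (egf g) refl (egf-linear≉0 g g₁≉0))
      where
      conjugate : Σ Series (RightInverseOf (egf g)) → NegationConjugate f
      conjugate (h , h-inverse) = record
        { g = egf g ; h = h ; g₀≈0 = refl ; g₁≉0 = egf-linear≉0 g g₁≉0 ; h-inverse = h-inverse
        ; f≋g∘-h = taylor-injective (trans f₀≈0 (sym (compS-constant (egf g) (negS h))))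
                                    (λ n → trans (taylor-f≈L n) (L≈taylor-compS-neg n)) }
        where open InverseCoefficients g g₁≉0 h h-inverse

theorem4p2 : ∀ {c ℓ : Level} (F : Field c ℓ) →
    let open Field F
        open FieldTheory F
    in CharZero →
       (f : Series) → Invertible f → ¬ (∀ n → f n ≈ idS n) →
       ((∀ n → compS f f n ≈ idS n)
         ⇔ Σ (ℕ → Carrier) (λ g → ¬ (g 1 ≈ 0#) × (∀ n → taylor f (suc n) ≈ L (suc n) 1 g)))
theorem4p2 F charZero f (f₀≈0 , _) f≉id =
  mk⇔ (NegationConjugate⇒HasLahCoefficients ∘ involutory⇒NegationConjugate f₀≈0 f≉id)
      (NegationConjugate⇒involutory ∘ HasLahCoefficients⇒NegationConjugate f₀≈0)
  where
  open PowerSeries F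
  open CharacteristicZero charZero
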